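{- Let $G_1$ and $G_2$ be simple graphs on a common vertex set $V$ of size $n$, with $\Delta_2=\Delta(G_2)$, and suppose that $G_1^+$ is $k$-regular and $|V(G_1^+)|$ is even. If $|V(G_1^+)|\ge 2\Delta_2+2(k-1)$, then for every $X\subseteq V$ with $|X|=|V(G_1^+)|$ there is a simple graph $H$ on vertex set $X$ with the same degree sequence as $G_1^+$, containing $k$ pairwise edge-disjoint perfect matchings ($1$-factors), such that $E(H)\cap E(G_2[X])=\emptyset$, unless $|V(G_1^+)|=2\Delta_2$ and either (i) $G_1^+\cong \Delta_2K^2$ and $G_2[X]\cong K^{\Delta_2,\Delta_2}$ with $\Delta_2$ odd, or (ii) $G_1^+\cong\Delta_2K^2$ and $G_2[X]$ contains a subgraph isomorphic to $K^{\Delta_2+1}$.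
   Context: All graphs are finite and simple. $G^+$ denotes the subgraph of $G$ induced by the vertices of degree at least one; $G[X]$ is the subgraph induced by $X$. $kG$ is the disjoint union of $k$ copies of $G$; $K^m$ is the complete graph on $m$ vertices and $K^{m,m}$ the complete balanced bipartite graph with parts of size $m$. A $1$-factor of $H$ is a spanning $1$-regular subgraph. -}

module Defs where

open import Data.Nat using (ℕ; zero; suc; _+_; _*_; _⊔_; _/_; _≡ᵇ_; _<ᵇ_)
open import Data.Bool using (Bool; true; false; not; _∧_; _xor_)
open import Data.Bool.Properties using (∧-zeroʳ; xor-same)
open import Data.Fin using (Fin; toℕ)
open import Data.Fin.Subset using (Subset; _∈_; ∣_∣)
open import Data.Vec using (Vec; []; _∷_; tabulate)
open import Data.List using (List; map; foldr; allFin)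
import Data.List as L
open import Data.List.Relation.Binary.Permutation.Propositional using (_↭_)
open import Data.Product using (Σ; _×_; ∃)
open import Function.Definitions using (Injective)
open import Relation.Binary.PropositionalEquality using (_≡_; refl; cong; cong₂)

record Graph (n : ℕ) : Set where
  field
    adj    : Fin n → Fin n → Bool
    sym    : ∀ u v → adj u v ≡ adj v u
    irrefl : ∀ v → adj v v ≡ false
open Graph public

N : ∀ {n} → Graph n → Fin n → Subset n
N G v = tabulate (adj G v)

deg : ∀ {n} → Graph n → Fin n → ℕ
deg G v = ∣ N G v ∣

maxDeg : ∀ {n} → Graph n → ℕ
maxDeg {n} G = foldr _⊔_ 0 (map (deg G) (allFin n))

-- V(G⁺): vertices of degree at least one.
supp : ∀ {n} → Graph n → Subset n
supp G = tabulate (λ v → not (deg G v ≡ᵇ 0))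

elems : ∀ {n} → Subset n → List (Fin n)
elems []          = L.[]
elems (true ∷ p)  = Fin.zero L.∷ map Fin.suc (elems p)
  where import Data.Fin as Fin
elems (false ∷ p) = map Fin.suc (elems p)
  where import Data.Fin as Fin

-- Degree sequence of G restricted to the vertex set S (as a multiset,
-- compared up to permutation).
degSeq : ∀ {n} → Graph n → Subset n → List ℕ
degSeq G S = map (deg G) (elems S)

PlusRegular : ∀ {n} → Graph n → ℕ → Set
PlusRegular G k = ∀ v → v ∈ supp G → deg G v ≡ k

OnVertexSet : ∀ {n} → Graph n → Subset n → Set
OnVertexSet H X = ∀ u v → adj H u v ≡ true → u ∈ X

_⊆G_ : ∀ {n} → Graph n → Graph n → Set
M ⊆G H = ∀ u v → adj M u v ≡ true → adj H u v ≡ true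

OneFactor : ∀ {n} → Graph n → Subset n → Graph n → Set
OneFactor H X M = M ⊆G H × (∀ x → x ∈ X → deg M x ≡ 1)

EdgeDisjoint : ∀ {n} → Graph n → Graph n → Set
EdgeDisjoint M M' = ∀ u v → adj M u v ≡ true → adj M' u v ≡ false

InducedIso : ∀ {n m} → Graph n → Subset n → Graph m → Set
InducedIso {n} {m} G S K =
  Σ (Fin m → Fin n) λ f →
    Injective _≡_ _≡_ f
    × (∀ i → f i ∈ S)
    × (∀ v → v ∈ S → ∃ λ i → f i ≡ v)
    × (∀ i j → adj G (f i) (f j) ≡ adj K i j)

ContainsSub : ∀ {n m} → Graph n → Subset n → Graph m → Set
ContainsSub {n} {m} G S K =
  Σ (Fin m → Fin n) λ f →
    Injective _≡_ _≡_ f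
    × (∀ i → f i ∈ S)
    × (∀ i j → adj K i j ≡ true → adj G (f i) (f j) ≡ true)

≡ᵇ-sym : ∀ a b → (a ≡ᵇ b) ≡ (b ≡ᵇ a)
≡ᵇ-sym zero zero = refl
≡ᵇ-sym zero (suc b) = refl
≡ᵇ-sym (suc a) zero = refl
≡ᵇ-sym (suc a) (suc b) = ≡ᵇ-sym a b

≡ᵇ-refl : ∀ a → (a ≡ᵇ a) ≡ true
≡ᵇ-refl zero = refl
≡ᵇ-refl (suc a) = ≡ᵇ-refl a

xor-comm′ : ∀ x y → (x xor y) ≡ (y xor x)
xor-comm′ true true = refl
xor-comm′ true false = refl
xor-comm′ false true = refl
xor-comm′ false false = refl

complete : (m : ℕ) → Graph m
complete m = record
  { adj    = λ u v → not (toℕ u ≡ᵇ toℕ v)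
  ; sym    = λ u v → cong not (≡ᵇ-sym (toℕ u) (toℕ v))
  ; irrefl = λ v → cong not (≡ᵇ-refl (toℕ v)) }

-- d K^2 : d disjoint edges on Fin (2 * d); vertices 2i and 2i+1 are paired.
matching : (d : ℕ) → Graph (2 * d)
matching d = record
  { adj    = λ u v → ((toℕ u / 2) ≡ᵇ (toℕ v / 2)) ∧ not (toℕ u ≡ᵇ toℕ v)
  ; sym    = λ u v → cong₂ _∧_ (≡ᵇ-sym (toℕ u / 2) (toℕ v / 2))
                               (cong not (≡ᵇ-sym (toℕ u) (toℕ v)))
  ; irrefl = λ v → helper (toℕ v) }
  where
  helper : ∀ a → ((a / 2) ≡ᵇ (a / 2)) ∧ not (a ≡ᵇ a) ≡ false
  helper a rewrite ≡ᵇ-refl a = ∧-zeroʳ _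

-- K^{d,d} on Fin (2 * d): parts {0..d-1} and {d..2d-1}.
completeBip : (d : ℕ) → Graph (2 * d)
completeBip d = record
  { adj    = λ u v → (toℕ u <ᵇ d) xor (toℕ v <ᵇ d)
  ; sym    = λ u v → xor-comm′ (toℕ u <ᵇ d) (toℕ v <ᵇ d)
  ; irrefl = λ v → xor-same (toℕ v <ᵇ d) }

-- Work inside X with the graph of allowed pairs: distinct vertices of X that are not adjacent
-- in G₂.  Every vertex of X has at least |X| − Δ₂ − 1 allowed neighbours.  A matching of
-- allowed pairs that leaves two vertices u, v of X unmatched can be enlarged along a path of
-- length 1, 3 or 5, unless counting the neighbours of u and v along matching edges makes every
-- inequality tight; by the size hypothesis this pins down |X| = 2Δ₂ and G₂[X] as either
-- K^{Δ₂,Δ₂} with Δ₂ odd or a graph containing K^{Δ₂+1}.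
-- The k matchings are then found one at a time: once a perfect matching P is chosen, its edges
-- are added to G₂ (so Δ₂ grows by one while k drops by one) and the remaining matchings are
-- found by induction.  When this recursive call meets the extremal structure (only possible
-- when it asks for a single matching), the last two matchings are built by hand by exchanging
-- two edges of P.  The union of the k matchings is k-regular on X, hence has the degree sequence
-- of G₁⁺; and in the remaining extremal case G₁⁺, being 1-regular on 2Δ₂ vertices, is Δ₂K².

module Submission where

open import Algebra.Definitions using (Involutive)
import Algebra.Properties.CommutativeMonoid.Sum as CommutativeMonoidSum
open import Data.Bool using (Bool; true; false; not; _∧_; _∨_; _xor_; if_then_else_)
import Data.Bool as Bool
open import Data.Bool.Properties
  using (∧-comm; ∧-identityʳ; ∧-zeroʳ; ∧-conicalˡ; ∧-conicalʳ; ∨-conicalˡ; ∨-conicalʳ; not-injective; not-¬; ¬-not; not-involutive)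
open import Data.Empty using (⊥; ⊥-elim)
open import Data.Fin using (Fin; toℕ; fromℕ<; splitAt; _↑ˡ_; _↑ʳ_) renaming (zero to fz; suc to fs)
open import Data.Fin.Permutation using (permutation)
import Data.Fin.Properties as FP
open import Data.Fin.Subset using (Subset; _∈_; ∣_∣)
open import Data.List using (List; []; _∷_; map; foldr; allFin; length; replicate)
open import Data.List.Membership.Propositional.Properties using (∈-allFin; ∈-map⁺)
import Data.List.Membership.Propositional as LM
open import Data.List.Relation.Binary.Permutation.Propositional using (_↭_; ↭-reflexive)
open import Data.List.Relation.Unary.All using (All)
import Data.List.Relation.Unary.All as All
import Data.List.Relation.Unary.All.Properties as AllP
open import Data.List.Relation.Unary.Any using (here; there)
open import Data.Nat using (ℕ; zero; suc; _+_; _*_; _≤_; _<_; z≤n; s≤s; _⊔_; _≡ᵇ_; _<ᵇ_; _/_; _%_)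
open import Data.Nat.DivMod using (m≡m%n+[m/n]*n; +-distrib-/; m<n⇒m/n≡0; m*n/n≡m; m<n⇒m%n≡m; m*n%n≡0; [m+kn]%n≡m%n; m%n<n)
open import Data.Nat.Properties
open import Data.Nat.Tactic.RingSolver
open import Data.Product using (Σ; _×_; _,_; proj₁; proj₂; ∃)
open import Data.Sum using (_⊎_; inj₁; inj₂; [_,_]′)
open import Data.Unit using (tt)
open import Data.Vec using (Vec; tabulate; lookup)
import Data.Vec as Vec
open import Data.Vec.Properties using (lookup∘tabulate; []=⇒lookup; lookup⇒[]=)
open import Function using (_∘_)
open import Function.Definitions using (Injective)
open import Relation.Binary using (tri<; tri≈; tri>)
open import Relation.Binary.PropositionalEquality
open import Relation.Nullary using (¬_; yes; no; does)
open import Relation.Nullary.Decidable using (dec-true; dec-false)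

open import Defs hiding (sym)

_==_ : ∀ {n} → Fin n → Fin n → Bool
x == y = does (x FP.≟ y)

==⇒≡ : ∀ {n} {x y : Fin n} → x == y ≡ true → x ≡ y
==⇒≡ {x = x} {y} e with x FP.≟ y
... | yes x≡y = x≡y

==-refl : ∀ {n} (x : Fin n) → x == x ≡ true
==-refl x = dec-true (x FP.≟ x) refl

≢⇒==-false : ∀ {n} {x y : Fin n} → x ≢ y → x == y ≡ false
≢⇒==-false {x = x} {y} = dec-false (x FP.≟ y)

==-sym : ∀ {n} (x y : Fin n) → x == y ≡ y == x
==-sym x y with x FP.≟ y | y FP.≟ x
... | yes _   | yes _   = refl
... | no _    | no _    = refl
... | yes x≡y | no y≢x  = ⊥-elim (y≢x (sym x≡y))
... | no x≢y  | yes y≡x = ⊥-elim (x≢y (sym y≡x))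

indicator : Bool → ℕ
indicator true  = 1
indicator false = 0

open CommutativeMonoidSum +-0-commutativeMonoid using (sum; sum-cong-≗; ∑-distrib-+; sum-permute)

count : ∀ {n} → (Fin n → Bool) → ℕ
count f = sum (indicator ∘ f)

sum-mono-≤ : ∀ {n} {f g : Fin n → ℕ} → (∀ x → f x ≤ g x) → sum f ≤ sum g
sum-mono-≤ {zero}  f≤g = z≤n
sum-mono-≤ {suc n} f≤g = +-mono-≤ (f≤g fz) (sum-mono-≤ (f≤g ∘ fs))

sum-mono-tight : ∀ {n} {f g : Fin n → ℕ} → (∀ x → f x ≤ g x) → sum g ≤ sum f → ∀ x → f x ≡ g x
sum-mono-tight {suc n} {f} {g} f≤g g≤f = pointwise
  where
  rest≤ : sum (f ∘ fs) ≤ sum (g ∘ fs)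
  rest≤ = sum-mono-≤ (f≤g ∘ fs)
  head≡ : f fz ≡ g fz
  head≡ = ≤-antisym (f≤g fz) (+-cancelʳ-≤ (sum (g ∘ fs)) (g fz) (f fz)
            (≤-trans g≤f (+-monoʳ-≤ (f fz) rest≤)))
  pointwise : ∀ x → f x ≡ g x
  pointwise fz     = head≡
  pointwise (fs x) = sum-mono-tight (f≤g ∘ fs)
    (+-cancelˡ-≤ (g fz) _ _ (≤-trans g≤f (≤-reflexive (cong (_+ sum (f ∘ fs)) head≡)))) x

count≤n : ∀ {n} (f : Fin n → Bool) → count f ≤ n
count≤n {zero}  f = z≤n
count≤n {suc n} f = +-mono-≤ (indicator≤1 (f fz)) (count≤n (f ∘ fs))
  where
  indicator≤1 : ∀ b → indicator b ≤ 1
  indicator≤1 true  = s≤s z≤n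
  indicator≤1 false = z≤n

_⊆ᵇ_ : ∀ {n} → (Fin n → Bool) → (Fin n → Bool) → Set
f ⊆ᵇ g = ∀ x → f x ≡ true → g x ≡ true

count-mono : ∀ {n} {f g : Fin n → Bool} → f ⊆ᵇ g → count f ≤ count g
count-mono {f = f} f⊆g = sum-mono-≤ (λ x → indicator-mono (f x) (f⊆g x))
  where
  indicator-mono : ∀ a {b} → (a ≡ true → b ≡ true) → indicator a ≤ indicator b
  indicator-mono true  a⇒b rewrite a⇒b refl = ≤-refl
  indicator-mono false a⇒b = z≤n

count-cong : ∀ {n} {f g : Fin n → Bool} → (∀ x → f x ≡ g x) → count f ≡ count g
count-cong f≗g = sum-cong-≗ (cong indicator ∘ f≗g)

count-split : ∀ {n} (f g : Fin n → Bool) →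
  count f ≡ count (λ x → f x ∧ g x) + count (λ x → f x ∧ not (g x))
count-split f g = trans (sum-cong-≗ (λ x → split (f x) (g x)))
                        (∑-distrib-+ (λ x → indicator (f x ∧ g x)) (λ x → indicator (f x ∧ not (g x))))
  where
  split : ∀ a b → indicator a ≡ indicator (a ∧ b) + indicator (a ∧ not b)
  split true true  = refl
  split true false = refl
  split false b    = refl

count-∨ : ∀ {n} (f g : Fin n → Bool) → count (λ x → f x ∨ g x) ≤ count f + count g
count-∨ f g = ≤-trans (sum-mono-≤ (λ x → subadditive (f x) (g x)))
                      (≤-reflexive (∑-distrib-+ (indicator ∘ f) (indicator ∘ g)))
  where
  subadditive : ∀ a b → indicator (a ∨ b) ≤ indicator a + indicator b
  subadditive true  b = s≤s z≤n
  subadditive false b = ≤-refl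

count-none : ∀ {n} (f : Fin n → Bool) → (∀ x → f x ≡ false) → count f ≡ 0
count-none {zero}  f none = refl
count-none {suc n} f none rewrite none fz = count-none (f ∘ fs) (none ∘ fs)

count-== : ∀ {n} (a : Fin n) → count (_== a) ≡ 1
count-== {suc n} fz     = cong suc (count-none {n} (λ x → fs x == fz) (λ x → ≢⇒==-false {x = fs x} {fz} λ ()))
count-== {suc n} (fs a) = count-== a

count-witness : ∀ {n} (f : Fin n → Bool) → 1 ≤ count f → Σ (Fin n) λ x → f x ≡ true
count-witness {suc n} f pos with f fz in f0
... | true  = fz , f0
... | false = let (x , fx) = count-witness (f ∘ fs) pos in fs x , fx

count-≥1 : ∀ {n} (f : Fin n → Bool) (a : Fin n) → f a ≡ true → 1 ≤ count f
count-≥1 f a fa = ≤-trans (≤-reflexive (sym (count-== a)))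
  (count-mono {g = f} (λ x x==a → subst (λ z → f z ≡ true) (sym (==⇒≡ x==a)) fa))

count-mono-< : ∀ {n} {f g : Fin n → Bool} → f ⊆ᵇ g →
  (a : Fin n) → g a ≡ true → f a ≡ false → suc (count f) ≤ count g
count-mono-< {f = f} {g} f⊆g a ga fa = begin
    suc (count f)                                             ≡⟨ +-comm 1 (count f) ⟩
    count f + 1                                               ≤⟨ +-mono-≤ (≤-reflexive (count-cong f≡g∧f))
                                                                          (count-≥1 _ a (a∈g∖f ga fa)) ⟩
    count (λ x → g x ∧ f x) + count (λ x → g x ∧ not (f x))  ≡⟨ count-split g f ⟨
    count g                                                   ∎
  where
  open ≤-Reasoning
  f≡g∧f : ∀ x → f x ≡ (g x ∧ f x)
  f≡g∧f x with f x in fx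
  ... | true rewrite f⊆g x fx = refl
  ... | false = sym (∧-zeroʳ (g x))
  a∈g∖f : g a ≡ true → f a ≡ false → (g a ∧ not (f a)) ≡ true
  a∈g∖f ga fa rewrite ga | fa = refl

count-⊆-full : ∀ {n} {f g : Fin n → Bool} → f ⊆ᵇ g → count g ≤ count f → g ⊆ᵇ f
count-⊆-full {f = f} f⊆g g≤f x gx with f x in fx
... | true  = refl
... | false = ⊥-elim (<-irrefl refl (≤-trans (count-mono-< f⊆g x gx fx) g≤f))

count-∘-involution : ∀ {n} (σ : Fin n → Fin n) → Involutive _≡_ σ →
  (f : Fin n → Bool) → count (f ∘ σ) ≡ count f
count-∘-involution σ σσ f = sym (sum-permute (indicator ∘ f) (permutation σ σ σσ σσ))

_<ᶠ_ : ∀ {n} → Fin n → Fin n → Bool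
x <ᶠ y = toℕ x <ᵇ toℕ y

n<ᵇn≡false : ∀ n → (n <ᵇ n) ≡ false
n<ᵇn≡false zero    = refl
n<ᵇn≡false (suc n) = n<ᵇn≡false n

<ᵇ-trichotomy : ∀ m n → m ≢ n → indicator (m <ᵇ n) + indicator (n <ᵇ m) ≡ 1
<ᵇ-trichotomy zero    zero    m≢n = ⊥-elim (m≢n refl)
<ᵇ-trichotomy zero    (suc n) m≢n = refl
<ᵇ-trichotomy (suc m) zero    m≢n = refl
<ᵇ-trichotomy (suc m) (suc n) m≢n = <ᵇ-trichotomy m n (m≢n ∘ cong suc)

count-moved≡2*ascents : ∀ {n} (σ : Fin n → Fin n) → Involutive _≡_ σ →
  count (λ x → not (σ x == x)) ≡ 2 * count (λ x → x <ᶠ σ x)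
count-moved≡2*ascents {n} σ σσ = begin
    count (λ x → not (σ x == x))                ≡⟨ sum-cong-≗ moved≡ascent+descent ⟩
    sum (λ x → indicator (ascent x) + indicator (ascent (σ x)))
                                                ≡⟨ ∑-distrib-+ (indicator ∘ ascent) (indicator ∘ ascent ∘ σ) ⟩
    count ascent + count (ascent ∘ σ)           ≡⟨ cong (count ascent +_) (count-∘-involution σ σσ ascent) ⟩
    count ascent + count ascent                 ≡⟨ cong (count ascent +_) (+-identityʳ _) ⟨
    2 * count ascent                            ∎
  where
  open ≡-Reasoning
  ascent : Fin n → Bool
  ascent x = x <ᶠ σ x
  moved≡ascent+descent : ∀ x → indicator (not (σ x == x)) ≡ indicator (ascent x) + indicator (ascent (σ x))
  moved≡ascent+descent x rewrite σσ x with σ x FP.≟ x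
  ... | yes σx≡x = sym (subst (λ y → indicator (toℕ x <ᵇ toℕ y) + indicator (toℕ y <ᵇ toℕ x) ≡ 0)
                             (sym σx≡x) (cong (λ b → indicator b + indicator b) (n<ᵇn≡false (toℕ x))))
  ... | no σx≢x = sym (<ᵇ-trichotomy (toℕ x) (toℕ (σ x)) (σx≢x ∘ sym ∘ FP.toℕ-injective))

search : ∀ {n} (f : Fin n → Bool) → (Σ (Fin n) λ x → f x ≡ true) ⊎ (∀ x → f x ≡ false)
search f with FP.any? (λ x → f x Bool.≟ true)
... | yes found = inj₁ found
... | no none   = inj₂ (λ x → ¬-not (λ fx → none (x , fx)))

search₂ : ∀ {n} (f : Fin n → Fin n → Bool) →
  (Σ (Fin n) λ x → Σ (Fin n) λ y → f x y ≡ true) ⊎ (∀ x y → f x y ≡ false)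
search₂ f with FP.any? (λ x → FP.any? (λ y → f x y Bool.≟ true))
... | yes found = inj₁ found
... | no none   = inj₂ (λ x y → ¬-not (λ fxy → none (x , y , fxy)))

anyᵇ : ∀ {n} → (Fin n → Bool) → Bool
anyᵇ {zero}  f = false
anyᵇ {suc n} f = f fz ∨ anyᵇ (f ∘ fs)

==-false⇒≢ : ∀ {n} {x y : Fin n} → x == y ≡ false → x ≢ y
==-false⇒≢ {x = x} e refl = not-¬ (==-refl x) e

∧-intro : ∀ {a b} → a ≡ true → b ≡ true → a ∧ b ≡ true
∧-intro refl refl = refl

true-or-false : ∀ (a : Bool) → a ≡ true ⊎ a ≡ false
true-or-false true  = inj₁ refl
true-or-false false = inj₂ refl

≡-or-≢ : ∀ {n} (x y : Fin n) → x ≡ y ⊎ x ≢ y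
≡-or-≢ x y with x FP.≟ y
... | yes x≡y = inj₁ x≡y
... | no x≢y  = inj₂ x≢y

-- A matching is an involution whose fixed points are the unmatched vertices.  pairUp σ a b
-- matches a with b; the former partners of a and b become unmatched.
pairUp : ∀ {n} → (Fin n → Fin n) → Fin n → Fin n → Fin n → Fin n
pairUp partner a b x = if x == a then b else (if x == b then a else (if partner x == a then x else (if partner x == b then x else partner x)))

remove : ∀ {n} → (Fin n → Bool) → Fin n → Fin n → Bool
remove P a x = P x ∧ not (x == a)

count-remove : ∀ {n} (P : Fin n → Bool) (a : Fin n) → P a ≡ true → count P ≡ suc (count (remove P a))
count-remove P a Pa = trans (count-split P (λ x → not (x == a)))
  (trans (+-comm _ (count (λ x → P x ∧ not (not (x == a)))))
   (cong (_+ count (remove P a)) (trans (count-cong e) (count-== a))))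
  where
  e : ∀ x → (P x ∧ not (not (x == a))) ≡ (x == a)
  e x with ≡-or-≢ x a
  ... | inj₁ refl rewrite Pa | ==-refl x = refl
  ... | inj₂ x≢a rewrite ≢⇒==-false x≢a = ∧-zeroʳ (P x)

remove-⊆ : ∀ {n} (P : Fin n → Bool) (a : Fin n) {x} → remove P a x ≡ true → P x ≡ true
remove-⊆ P a {x} e = ∧-conicalˡ (P x) _ e

remove-≢ : ∀ {n} (P : Fin n → Bool) (a : Fin n) {x} → remove P a x ≡ true → x ≢ a
remove-≢ P a {x} e = ==-false⇒≢ (not-injective (∧-conicalʳ (P x) _ e))

remove-false : ∀ {n} (P : Fin n → Bool) (a : Fin n) {x} → P x ≡ false → remove P a x ≡ false
remove-false P a e rewrite e = refl

module _ {n : ℕ} (partner : Fin n → Fin n) (a b : Fin n) where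
  pairUp-a : pairUp partner a b a ≡ b
  pairUp-a rewrite ==-refl a = refl

  pairUp-b : a ≢ b → pairUp partner a b b ≡ a
  pairUp-b ne rewrite ≢⇒==-false (λ e → ne (sym e)) | ==-refl b = refl

  pairUp-other : ∀ x → x ≢ a → x ≢ b → partner x ≢ a → partner x ≢ b → pairUp partner a b x ≡ partner x
  pairUp-other x n1 n2 n3 n4 rewrite ≢⇒==-false n1 | ≢⇒==-false n2 | ≢⇒==-false n3 | ≢⇒==-false n4 = refl

  pairUp-widowed : ∀ x → x ≢ a → x ≢ b → (partner x ≡ a ⊎ partner x ≡ b) → pairUp partner a b x ≡ x
  pairUp-widowed x n1 n2 (inj₁ e) rewrite ≢⇒==-false n1 | ≢⇒==-false n2 | e | ==-refl a = refl
  pairUp-widowed x n1 n2 (inj₂ e) with partner x == a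
  ... | true rewrite ≢⇒==-false n1 | ≢⇒==-false n2 = refl
  ... | false rewrite ≢⇒==-false n1 | ≢⇒==-false n2 | e | ==-refl b = refl

  pairUp-involutive : Involutive _≡_ partner → a ≢ b → Involutive _≡_ (pairUp partner a b)
  pairUp-involutive involutive ne x with ≡-or-≢ x a
  ... | inj₁ refl rewrite pairUp-a = pairUp-b ne
  ... | inj₂ xa with ≡-or-≢ x b
  ... | inj₁ refl rewrite pairUp-b ne = pairUp-a
  ... | inj₂ xb with ≡-or-≢ (partner x) a
  ... | inj₁ pa rewrite pairUp-widowed x xa xb (inj₁ pa) = pairUp-widowed x xa xb (inj₁ pa)
  ... | inj₂ pxa with ≡-or-≢ (partner x) b
  ... | inj₁ pb rewrite pairUp-widowed x xa xb (inj₂ pb) = pairUp-widowed x xa xb (inj₂ pb)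
  ... | inj₂ pxb rewrite pairUp-other x xa xb pxa pxb =
        trans (pairUp-other (partner x) pxa pxb (λ e → xa (trans (sym (involutive x)) e)) (λ e → xb (trans (sym (involutive x)) e))) (involutive x)

module _ {n : ℕ} (partner : Fin n → Fin n) (involutive : Involutive _≡_ partner) (a b : Fin n) (ab : a ≢ b) where
  pairUp-keeps-moved : ∀ z → partner z ≢ z → z ≢ partner a → z ≢ partner b → pairUp partner a b z ≢ z
  pairUp-keeps-moved z mz za zb with ≡-or-≢ z a
  ... | inj₁ refl rewrite pairUp-a partner z b = λ e → ab (sym e)
  ... | inj₂ z≢a with ≡-or-≢ z b
  ... | inj₁ refl rewrite pairUp-b partner a z ab = ab
  ... | inj₂ z≢b = subst (λ w → w ≢ z) (sym (pairUp-other partner a b z z≢a z≢b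
          (λ e → za (trans (sym (involutive z)) (cong partner e)))
          (λ e → zb (trans (sym (involutive z)) (cong partner e))))) mz

  pairUp-moves-a : pairUp partner a b a ≢ a
  pairUp-moves-a rewrite pairUp-a partner a b = λ e → ab (sym e)

involution-== : ∀ {n} (σ : Fin n → Fin n) → Involutive _≡_ σ → ∀ x y → (σ x == y) ≡ (σ y == x)
involution-== σ σσ x y with σ x FP.≟ y | σ y FP.≟ x
... | yes _      | yes _      = refl
... | no _       | no _       = refl
... | yes σx≡y   | no σy≢x    = ⊥-elim (σy≢x (trans (cong σ (sym σx≡y)) (σσ x)))
... | no σx≢y    | yes σy≡x   = ⊥-elim (σx≢y (trans (cong σ (sym σy≡x)) (σσ y)))

module Matchings {n : ℕ} (allowed : Fin n → Fin n → Bool) (allowed-sym : ∀ x y → allowed x y ≡ allowed y x) where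

  record Matching : Set where
    constructor mkMatching
    field
      partner : Fin n → Fin n
      involutive : Involutive _≡_ partner
      respects : ∀ x → partner x ≢ x → allowed x (partner x) ≡ true
  open Matching public

  pairUpᴹ : (m : Matching) (a b : Fin n) → a ≢ b → allowed a b ≡ true → Matching
  pairUpᴹ (mkMatching partner involutive respects) a b ne g = mkMatching (pairUp partner a b) (pairUp-involutive partner a b involutive ne) ok'
    where
    ok' : ∀ x → pairUp partner a b x ≢ x → allowed x (pairUp partner a b x) ≡ true
    ok' x h with ≡-or-≢ x a
    ... | inj₁ refl rewrite pairUp-a partner x b = g
    ... | inj₂ xa with ≡-or-≢ x b
    ... | inj₁ refl rewrite pairUp-b partner a x ne = trans (allowed-sym x a) g
    ... | inj₂ xb with ≡-or-≢ (partner x) a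
    ... | inj₁ pa = ⊥-elim (h (pairUp-widowed partner a b x xa xb (inj₁ pa)))
    ... | inj₂ pxa with ≡-or-≢ (partner x) b
    ... | inj₁ pb = ⊥-elim (h (pairUp-widowed partner a b x xa xb (inj₂ pb)))
    ... | inj₂ pxb rewrite pairUp-other partner a b x xa xb pxa pxb = respects x h

  matchWithin : (m : ℕ) (P : Fin n → Bool) → count P ≡ m * 2 →
    (∀ x y → P x ≡ true → P y ≡ true → x ≢ y → allowed x y ≡ true) →
    (τ : Matching) → (∀ x → P x ≡ true → partner τ x ≡ x) →
    Σ Matching λ σ → (∀ x → P x ≡ false → partner σ x ≡ partner τ x) × (∀ x → P x ≡ true → P (partner σ x) ≡ true × partner σ x ≢ x)
  matchWithin zero P c allg τ fix = τ , (λ x _ → refl) , λ x Px → ⊥-elim (<-irrefl refl (≤-trans (count-≥1 P x Px) (≤-reflexive c)))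
  matchWithin (suc m) P c allg τ fix with count-witness P (subst (1 ≤_) (sym c) (s≤s z≤n))
  ... | (a , Pa) with count-witness (remove P a) (subst (1 ≤_) (sym (suc-injective (trans (sym (count-remove P a Pa)) c))) (s≤s z≤n))
  ... | b∃ = σ , out , inn
    where
    c1 : count (remove P a) ≡ suc (m * 2)
    c1 = suc-injective (trans (sym (count-remove P a Pa)) c)
    b = proj₁ b∃
    Pb = ∧-conicalˡ (P b) _ (proj₂ b∃)
    ba : b ≢ a
    ba = ==-false⇒≢ (not-injective (∧-conicalʳ (P b) _ (proj₂ b∃)))
    P' = remove (remove P a) b
    c2 : count P' ≡ m * 2
    c2 = suc-injective (trans (sym (count-remove (remove P a) b (proj₂ b∃))) c1)
    P'sub : ∀ x → P' x ≡ true → P x ≡ true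
    P'sub x e = ∧-conicalˡ (P x) _ (∧-conicalˡ (remove P a x) _ e)
    P'a : P' a ≡ false
    P'a rewrite ==-refl a | ∧-comm (P a) false = refl
    P'b : P' b ≡ false
    P'b rewrite ==-refl b | ∧-comm (remove P a b) false = refl
    rec = matchWithin m P' c2 (λ x y px py → allg x y (P'sub x px) (P'sub y py)) τ (λ x px → fix x (P'sub x px))
    σ' = proj₁ rec
    σ'a : partner σ' a ≡ a
    σ'a = trans (proj₁ (proj₂ rec) a P'a) (fix a Pa)
    σ'b : partner σ' b ≡ b
    σ'b = trans (proj₁ (proj₂ rec) b P'b) (fix b Pb)
    ab : a ≢ b
    ab e = ba (sym e)
    σ = pairUpᴹ σ' a b ab (allg a b Pa Pb ab)
    notab : ∀ x → P' x ≡ false → P x ≡ true → x ≡ a ⊎ x ≡ b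
    notab x e Px with ≡-or-≢ x a
    ... | inj₁ q = inj₁ q
    ... | inj₂ xa with ≡-or-≢ x b
    ... | inj₁ q = inj₂ q
    ... | inj₂ xb rewrite Px | ≢⇒==-false xa | ≢⇒==-false xb = ⊥-elim (not-¬ refl e)
    pxa : ∀ x → x ≢ a → partner σ' x ≢ a
    pxa x xa e = xa (trans (sym (involutive σ' x)) (trans (cong (partner σ') e) σ'a))
    pxb : ∀ x → x ≢ b → partner σ' x ≢ b
    pxb x xb e = xb (trans (sym (involutive σ' x)) (trans (cong (partner σ') e) σ'b))
    out : ∀ x → P x ≡ false → partner σ x ≡ partner τ x
    out x Px = trans (pairUp-other (partner σ') a b x xa xb (pxa x xa) (pxb x xb)) (proj₁ (proj₂ rec) x P'x)
      where
      xa : x ≢ a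
      xa refl = not-¬ Pa Px
      xb : x ≢ b
      xb refl = not-¬ Pb Px
      P'x : P' x ≡ false
      P'x rewrite Px = refl
    inn : ∀ x → P x ≡ true → P (partner σ x) ≡ true × partner σ x ≢ x
    inn x Px with true-or-false (P' x)
    ... | inj₁ P'x = subst (λ z → P z ≡ true) (sym e) (P'sub _ (proj₁ (proj₂ (proj₂ rec) x P'x))) ,
                      (λ q → proj₂ (proj₂ (proj₂ rec) x P'x) (trans (sym e) q))
      where
      xa : x ≢ a
      xa refl = not-¬ P'x P'a
      xb : x ≢ b
      xb refl = not-¬ P'x P'b
      e : partner σ x ≡ partner σ' x
      e = pairUp-other (partner σ') a b x xa xb (pxa x xa) (pxb x xb)
    ... | inj₂ P'x with notab x P'x Px
    ... | inj₁ refl = subst (λ w → P w ≡ true × w ≢ a) (sym (pairUp-a (partner σ') a b)) (Pb , (λ e → ab (sym e)))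
    ... | inj₂ refl = subst (λ w → P w ≡ true × w ≢ b) (sym (pairUp-b (partner σ') a b ab)) (Pa , ab)

  matchAcross : (m : ℕ) (P Q : Fin n → Bool) → count P ≡ m → count Q ≡ m →
    (∀ x → P x ≡ true → Q x ≡ false) →
    (∀ x y → P x ≡ true → Q y ≡ true → allowed x y ≡ true) →
    (τ : Matching) → (∀ x → P x ∨ Q x ≡ true → partner τ x ≡ x) →
    Σ Matching λ σ → (∀ x → P x ∨ Q x ≡ false → partner σ x ≡ partner τ x) ×
       (∀ x → P x ≡ true → Q (partner σ x) ≡ true) × (∀ x → Q x ≡ true → P (partner σ x) ≡ true)
  matchAcross zero P Q cp cq dj allg τ fix = τ , (λ x _ → refl) ,
     (λ x Px → ⊥-elim (<-irrefl refl (≤-trans (count-≥1 P x Px) (≤-reflexive cp)))) ,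
     (λ x Qx → ⊥-elim (<-irrefl refl (≤-trans (count-≥1 Q x Qx) (≤-reflexive cq))))
  matchAcross (suc m) P Q cp cq dj allg τ fix with count-witness P (subst (1 ≤_) (sym cp) (s≤s z≤n)) | count-witness Q (subst (1 ≤_) (sym cq) (s≤s z≤n))
  ... | (a , Pa) | (b , Qb) = σ , out , inP , inQ
    where
    ab : a ≢ b
    ab e = not-¬ (subst (λ z → Q z ≡ true) (sym e) Qb) (dj a Pa)
    P' = remove P a
    Q' = remove Q b
    cp' : count P' ≡ m
    cp' = suc-injective (trans (sym (count-remove P a Pa)) cp)
    cq' : count Q' ≡ m
    cq' = suc-injective (trans (sym (count-remove Q b Qb)) cq)
    P'sub : ∀ x → P' x ≡ true → P x ≡ true
    P'sub x e = ∧-conicalˡ (P x) _ e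
    Q'sub : ∀ x → Q' x ≡ true → Q x ≡ true
    Q'sub x e = ∧-conicalˡ (Q x) _ e
    or-l : ∀ {u v} → u ≡ true → u ∨ v ≡ true
    or-l refl = refl
    or-r : ∀ {u v} → v ≡ true → u ∨ v ≡ true
    or-r {true} refl = refl
    or-r {false} refl = refl
    fix' : ∀ x → P' x ∨ Q' x ≡ true → partner τ x ≡ x
    fix' x e with true-or-false (P' x)
    ... | inj₁ q = fix x (or-l (P'sub x q))
    ... | inj₂ q rewrite q = fix x (or-r (Q'sub x e))
    rec = matchAcross m P' Q' cp' cq' (λ x px → lem x (dj x (P'sub x px)))
            (λ x y px qy → allg x y (P'sub x px) (Q'sub y qy)) τ fix'
      where
      lem : ∀ x → Q x ≡ false → Q' x ≡ false
      lem x e rewrite e = refl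
    σ' = proj₁ rec
    P'a : P' a ≡ false
    P'a rewrite ==-refl a | ∧-comm (P a) false = refl
    Q'b : Q' b ≡ false
    Q'b rewrite ==-refl b | ∧-comm (Q b) false = refl
    Q'a : Q' a ≡ false
    Q'a rewrite dj a Pa = refl
    P'b : P' b ≡ false
    P'b with true-or-false (P b)
    ... | inj₁ q = ⊥-elim (not-¬ Qb (dj b q))
    ... | inj₂ q rewrite q = refl
    σ'a : partner σ' a ≡ a
    σ'a = trans (proj₁ (proj₂ rec) a (subst (λ z → z ∨ Q' a ≡ false) (sym P'a) Q'a)) (fix a (or-l Pa))
    σ'b : partner σ' b ≡ b
    σ'b = trans (proj₁ (proj₂ rec) b (subst (λ z → z ∨ Q' b ≡ false) (sym P'b) Q'b)) (fix b (or-r Qb))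
    σ = pairUpᴹ σ' a b ab (allg a b Pa Qb)
    pxa : ∀ x → x ≢ a → partner σ' x ≢ a
    pxa x xa e = xa (trans (sym (involutive σ' x)) (trans (cong (partner σ') e) σ'a))
    pxb : ∀ x → x ≢ b → partner σ' x ≢ b
    pxb x xb e = xb (trans (sym (involutive σ' x)) (trans (cong (partner σ') e) σ'b))
    out : ∀ x → P x ∨ Q x ≡ false → partner σ x ≡ partner τ x
    out x e = trans (pairUp-other (partner σ') a b x xa xb (pxa x xa) (pxb x xb)) (proj₁ (proj₂ rec) x e')
      where
      xa : x ≢ a
      xa refl = not-¬ refl (trans (sym (or-l Pa)) e)
      xb : x ≢ b
      xb refl = not-¬ refl (trans (sym (or-r {P x} Qb)) e)
      e' : P' x ∨ Q' x ≡ false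
      e' rewrite ∨-conicalˡ (P x) _ e | ∨-conicalʳ (P x) _ e = refl
    inP : ∀ x → P x ≡ true → Q (partner σ x) ≡ true
    inP x Px with ≡-or-≢ x a
    ... | inj₁ refl = subst (λ w → Q w ≡ true) (sym (pairUp-a (partner σ') a b)) Qb
    ... | inj₂ xa = subst (λ z → Q z ≡ true) (sym (pairUp-other (partner σ') a b x xa xb (pxa x xa) (pxb x xb)))
                    (Q'sub _ (proj₁ (proj₂ (proj₂ rec)) x P'x))
      where
      xb : x ≢ b
      xb refl = not-¬ Px (subst (λ z → P z ≡ false) refl (lemPb))
        where lemPb : P x ≡ false
              lemPb with true-or-false (P x)
              ... | inj₁ q = ⊥-elim (not-¬ Qb (dj x q))
              ... | inj₂ q = q
      P'x : P' x ≡ true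
      P'x rewrite Px | ≢⇒==-false xa = refl
    inQ : ∀ x → Q x ≡ true → P (partner σ x) ≡ true
    inQ x Qx with ≡-or-≢ x b
    ... | inj₁ refl = subst (λ w → P w ≡ true) (sym (pairUp-b (partner σ') a b ab)) Pa
    ... | inj₂ xb = subst (λ z → P z ≡ true) (sym (pairUp-other (partner σ') a b x xa xb (pxa x xa) (pxb x xb)))
                    (P'sub _ (proj₂ (proj₂ (proj₂ rec)) x Q'x))
      where
      xa : x ≢ a
      xa refl = not-¬ Qx (dj x Pa)
      Q'x : Q' x ≡ true
      Q'x rewrite Qx | ≢⇒==-false xb = refl

tight-counts : ∀ du dv mt un N Δ → du + dv ≤ mt → N ≡ mt + un → 2 ≤ un → N ≤ du + Δ + 1 → N ≤ dv + Δ + 1 →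
  Δ + Δ ≤ N →
   (un ≡ 2) × (N ≡ Δ + Δ) × (du + dv ≡ mt) × (suc du ≡ Δ) × (suc dv ≡ Δ)
tight-counts du dv mt un N Δ h1 h2 h3 h4 h5 h6 = un≡2 , N≡ , du+dv≡mt , 1+du≡Δ , 1+dv≡Δ
  where
  e1 : (du + Δ + 1) + (dv + Δ + 1) ≡ (du + dv) + (Δ + Δ) + 2
  e1 = solve (du ∷ dv ∷ Δ ∷ [])
  e2 : mt + N + 2 ≡ N + (mt + 2)
  e2 = solve (mt ∷ N ∷ [])
  e3 : du + dv + N + 2 ≡ N + (du + dv + 2)
  e3 = solve (du ∷ dv ∷ N ∷ [])
  e4 : mt + (Δ + Δ) + 2 ≡ mt + 2 + (Δ + Δ)
  e4 = solve (mt ∷ Δ ∷ [])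
  e5 : du + Δ + 1 ≡ suc du + Δ
  e5 = solve (du ∷ Δ ∷ [])
  e6 : dv + Δ + 1 ≡ suc dv + Δ
  e6 = solve (dv ∷ Δ ∷ [])
  e7 : suc du + suc dv ≡ du + dv + 2
  e7 = solve (du ∷ dv ∷ [])
  h45 : N + N ≤ (du + dv) + (Δ + Δ) + 2
  h45 = subst (N + N ≤_) e1 (+-mono-≤ h4 h5)
  h7 : N + N ≤ N + (mt + 2)
  h7 = ≤-trans h45 (≤-trans (+-monoˡ-≤ 2 (+-mono-≤ h1 h6)) (≤-reflexive e2))
  h7' : N ≤ mt + 2
  h7' = +-cancelˡ-≤ N _ _ h7
  un≤ : un ≤ 2
  un≤ = +-cancelˡ-≤ mt _ _ (subst (_≤ mt + 2) h2 h7')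
  un≡2 : un ≡ 2
  un≡2 = ≤-antisym un≤ h3
  N≡mt+2 : N ≡ mt + 2
  N≡mt+2 = trans h2 (cong (mt +_) un≡2)
  h8 : N ≤ du + dv + 2
  h8 = +-cancelˡ-≤ N _ _ (≤-trans h45 (≤-trans (+-monoˡ-≤ 2 (+-monoʳ-≤ (du + dv) h6)) (≤-reflexive e3)))
  du+dv≡mt : du + dv ≡ mt
  du+dv≡mt = ≤-antisym h1 (+-cancelʳ-≤ 2 _ _ (subst (_≤ du + dv + 2) N≡mt+2 h8))
  N≤ : N ≤ Δ + Δ
  N≤ = +-cancelˡ-≤ N _ _ (≤-trans h45 (≤-reflexive (trans (cong (λ z → z + (Δ + Δ) + 2) du+dv≡mt)
        (trans e4 (cong (_+ (Δ + Δ)) (sym N≡mt+2))))))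
  N≡ : N ≡ Δ + Δ
  N≡ = ≤-antisym N≤ h6
  Δ≤u : Δ ≤ suc du
  Δ≤u = +-cancelʳ-≤ Δ _ _ (≤-trans (≤-reflexive (sym N≡)) (≤-trans h4 (≤-reflexive e5)))
  Δ≤v : Δ ≤ suc dv
  Δ≤v = +-cancelʳ-≤ Δ _ _ (≤-trans (≤-reflexive (sym N≡)) (≤-trans h5 (≤-reflexive e6)))
  total : suc du + suc dv ≡ Δ + Δ
  total = trans e7 (trans (cong (_+ 2) du+dv≡mt) (trans (sym N≡mt+2) N≡))
  1+du≡Δ : suc du ≡ Δ
  1+du≡Δ = ≤-antisym (+-cancelʳ-≤ Δ _ _ (≤-trans (+-monoʳ-≤ (suc du) Δ≤v) (≤-reflexive total))) Δ≤u
  1+dv≡Δ : suc dv ≡ Δ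
  1+dv≡Δ = ≤-antisym (+-cancelˡ-≤ Δ _ _ (≤-trans (+-monoˡ-≤ (suc dv) Δ≤u) (≤-reflexive total))) Δ≤v

degree-gap-impossible : ∀ dy du Δ → Δ + Δ ≤ dy + Δ + 1 → suc dy ≤ du → suc du ≡ Δ → ⊥
degree-gap-impossible dy du Δ h1 h2 h3 = <-irrefl refl (≤-trans (s≤s h2) (≤-trans (≤-reflexive h3) (≤-trans h1' (≤-reflexive (+-comm dy 1)))))
  where
  e : dy + Δ + 1 ≡ (dy + 1) + Δ
  e = solve (dy ∷ Δ ∷ [])
  h1' : Δ ≤ dy + 1
  h1' = +-cancelʳ-≤ Δ _ _ (≤-trans h1 (≤-reflexive e))

complement≡suc : ∀ a b Δ → a + b ≡ Δ + Δ → suc a ≡ Δ → b ≡ suc Δ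
complement≡suc a b Δ e1 e2 = +-cancelˡ-≡ a _ _ (trans e1 (trans (cong (_+ Δ) (sym e2)) (sym (+-suc a Δ))))

complement≡Δ : ∀ Δ s → suc (suc Δ) + s ≡ suc Δ + suc Δ → s ≡ Δ
complement≡Δ Δ s e = +-cancelˡ-≡ Δ s Δ (suc-injective (trans (suc-injective e) (+-suc Δ Δ)))

double≤⇒≤ : ∀ Δ g → suc Δ + suc Δ ≤ g + Δ + 1 → suc Δ ≤ g
double≤⇒≤ Δ g h = +-cancelʳ-≤ (suc Δ) _ _ (≤-trans h (≤-reflexive e))
  where
  e : g + Δ + 1 ≡ g + suc Δ
  e = solve (g ∷ Δ ∷ [])

size≥2 : ∀ Δ k N → Δ + Δ + k + k ≤ N + 2 → 2 ≤ k → 2 ≤ N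
size≥2 Δ k N h k2 = +-cancelʳ-≤ 2 2 N (≤-trans (+-mono-≤ k2 k2) (≤-trans (m≤n+m (k + k) (Δ + Δ)) (≤-trans (≤-reflexive e) h)))
  where
  e : Δ + Δ + (k + k) ≡ Δ + Δ + k + k
  e = solve (Δ ∷ k ∷ [])

2Δ+2k⇒Δ+Δ+k+k : ∀ Δ k S → 2 * Δ + 2 * k ≤ S + 2 → Δ + Δ + k + k ≤ S + 2
2Δ+2k⇒Δ+Δ+k+k Δ k S h = ≤-trans (≤-reflexive e) h
  where
  e : Δ + Δ + k + k ≡ 2 * Δ + 2 * k
  e = solve (Δ ∷ k ∷ [])

module Allowed {n : ℕ} (X : Fin n → Bool) (B : Fin n → Fin n → Bool)
  (Bsym : ∀ x y → B x y ≡ B y x) where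

  allowed : Fin n → Fin n → Bool
  allowed x y = X x ∧ (X y ∧ (not (x == y) ∧ not (B x y)))

  allowed-sym : ∀ x y → allowed x y ≡ allowed y x
  allowed-sym x y rewrite ==-sym x y | Bsym x y with X x | X y
  ... | true | true = refl
  ... | true | false = refl
  ... | false | true = refl
  ... | false | false = refl

  allowed-∈ˡ : ∀ {x y} → allowed x y ≡ true → X x ≡ true
  allowed-∈ˡ {x} e = ∧-conicalˡ (X x) _ e
  allowed-∈ʳ : ∀ {x y} → allowed x y ≡ true → X y ≡ true
  allowed-∈ʳ {x} {y} e = ∧-conicalˡ (X y) _ (∧-conicalʳ (X x) _ e)
  allowed⇒≢ : ∀ {x y} → allowed x y ≡ true → x ≢ y
  allowed⇒≢ {x} {y} e = ==-false⇒≢ (not-injective (∧-conicalˡ (not (x == y)) _ (∧-conicalʳ (X y) _ (∧-conicalʳ (X x) _ e))))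
  allowed⇒non-edge : ∀ {x y} → allowed x y ≡ true → B x y ≡ false
  allowed⇒non-edge {x} {y} e = not-injective (∧-conicalʳ (not (x == y)) _ (∧-conicalʳ (X y) _ (∧-conicalʳ (X x) _ e)))
  allowed-intro : ∀ {x y} → X x ≡ true → X y ≡ true → x ≢ y → B x y ≡ false → allowed x y ≡ true
  allowed-intro {x} {y} ex ey ne eb rewrite ex | ey | ≢⇒==-false ne | eb = refl
  allowed-irrefl : ∀ x → allowed x x ≡ false
  allowed-irrefl x with true-or-false (allowed x x)
  ... | inj₁ e = ⊥-elim (allowed⇒≢ e refl)
  ... | inj₂ e = e
  ¬allowed⇒edge : ∀ {x y} → X x ≡ true → X y ≡ true → x ≢ y → allowed x y ≡ false → B x y ≡ true
  ¬allowed⇒edge {x} {y} ex ey ne g with true-or-false (B x y)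
  ... | inj₁ e = e
  ... | inj₂ e = ⊥-elim (not-¬ (allowed-intro ex ey ne e) g)

  open Matchings allowed allowed-sym public

  moved : Matching → Fin n → Bool
  moved m y = not (partner m y == y)

  unmatched : Matching → Fin n → Bool
  unmatched m y = X y ∧ (partner m y == y)

  moved⇒∈X : (m : Matching) → ∀ {y} → partner m y ≢ y → X y ≡ true
  moved⇒∈X m {y} ne = allowed-∈ˡ (respects m y ne)

  unmatched-intro : (m : Matching) → ∀ {y} → X y ≡ true → partner m y ≡ y → unmatched m y ≡ true
  unmatched-intro m {y} ex e rewrite ex | e | ==-refl y = refl
  unmatched⇒fixed : (m : Matching) → ∀ {y} → unmatched m y ≡ true → partner m y ≡ y
  unmatched⇒fixed m {y} e = ==⇒≡ (∧-conicalʳ (X y) _ e)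
  unmatched⇒∈X : (m : Matching) → ∀ {y} → unmatched m y ≡ true → X y ≡ true
  unmatched⇒∈X m {y} e = ∧-conicalˡ (X y) _ e

  partner-moved : (m : Matching) → ∀ {y} → partner m y ≢ y → partner m (partner m y) ≢ partner m y
  partner-moved m {y} ne e = ne (trans (sym e) (involutive m y))

  moved≢fixed : (m : Matching) → ∀ {z u} → partner m z ≢ z → partner m u ≡ u → z ≢ u
  moved≢fixed m mz fu refl = mz fu

  Improvement : Matching → Set
  Improvement m = Σ Matching λ m' → (unmatched m' ⊆ᵇ unmatched m) × Σ (Fin n) λ w → unmatched m w ≡ true × unmatched m' w ≡ false

  improvement : (m m' : Matching) → (∀ z → partner m z ≢ z → partner m' z ≢ z) → (w : Fin n) →
    unmatched m w ≡ true → partner m' w ≢ w → Improvement m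
  improvement m m' keep w uw hw = m' , sub , w , uw , lem
    where
    sub : unmatched m' ⊆ᵇ unmatched m
    sub z e with ≡-or-≢ (partner m z) z
    ... | inj₁ fz' = unmatched-intro m (∧-conicalˡ (X z) _ e) fz'
    ... | inj₂ nz = ⊥-elim (keep z nz (unmatched⇒fixed m' e))
    lem : unmatched m' w ≡ false
    lem with true-or-false (unmatched m' w)
    ... | inj₁ e = ⊥-elim (hw (unmatched⇒fixed m' e))
    ... | inj₂ e = e

  augment₁ : (m : Matching) (u w : Fin n) → unmatched m u ≡ true → unmatched m w ≡ true → allowed u w ≡ true →
    Improvement m
  augment₁ m u w uu uw g = improvement m m' keep u uu (pairUp-moves-a (partner m) (involutive m) u w uw')
    where
    uw' = allowed⇒≢ g
    m' = pairUpᴹ m u w uw' g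
    keep : ∀ z → partner m z ≢ z → partner m' z ≢ z
    keep z mz = pairUp-keeps-moved (partner m) (involutive m) u w uw' z mz
      (λ e → moved≢fixed m mz (unmatched⇒fixed m uu) (trans e (unmatched⇒fixed m uu)))
      (λ e → moved≢fixed m mz (unmatched⇒fixed m uw) (trans e (unmatched⇒fixed m uw)))

  augment₃ : (m : Matching) (u v x : Fin n) → u ≢ v → unmatched m u ≡ true → unmatched m v ≡ true →
    partner m x ≢ x →
         allowed u x ≡ true → allowed v (partner m x) ≡ true → Improvement m
  augment₃ m u v x u≢v uu uv mx g1 g2 = improvement m m2 keep u uu hitu
    where
    P = partner m
    fu = unmatched⇒fixed m uu
    fv = unmatched⇒fixed m uv
    ux : u ≢ x
    ux = allowed⇒≢ g1
    y = P x
    my : P y ≢ y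
    my = partner-moved m mx
    yv : y ≢ v
    yv e = moved≢fixed m my fv e
    m1 = pairUpᴹ m u x ux g1
    m2 = pairUpᴹ m1 y v yv (trans (allowed-sym y v) g2)
    P1 = partner m1
    P1y : P1 y ≡ y
    P1y = pairUp-widowed P u x y (moved≢fixed m my fu) mx (inj₂ (involutive m x))
    xv : x ≢ v
    xv = moved≢fixed m mx fv
    P1v : P1 v ≡ v
    P1v = trans (pairUp-other P u x v (≢-sym u≢v) (≢-sym xv) (λ e → u≢v (trans (sym e) fv)) (λ e → xv (trans (sym e) fv))) fv
    keep : ∀ z → P z ≢ z → partner m2 z ≢ z
    keep z mz with ≡-or-≢ z y
    ... | inj₁ refl = pairUp-moves-a P1 (involutive m1) z v yv
    ... | inj₂ zy = pairUp-keeps-moved P1 (involutive m1) y v yv z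
         (pairUp-keeps-moved P (involutive m) u x ux z mz (λ e → moved≢fixed m mz fu (trans e fu)) zy)
         (λ e → zy (trans e P1y)) (λ e → moved≢fixed m mz fv (trans e P1v))
    hitu : partner m2 u ≢ u
    hitu = pairUp-keeps-moved P1 (involutive m1) y v yv u (pairUp-moves-a P (involutive m) u x ux)
         (λ e → moved≢fixed m my fu (sym (trans e P1y))) (λ e → u≢v (trans e P1v))

  augment₅ : (m : Matching) (u a c v : Fin n) → u ≢ v → unmatched m u ≡ true → unmatched m v ≡ true →
         partner m a ≢ a → partner m c ≢ c → a ≢ c → c ≢ partner m a →
         allowed u a ≡ true → allowed (partner m a) c ≡ true → allowed (partner m c) v ≡ true → Improvement m
  augment₅ m u a c v u≢v uu uv ma mc a≢c c≢b g1 g2 g3 = improvement m m3 keep u uu hitu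
    where
    P = partner m
    fu = unmatched⇒fixed m uu
    fv = unmatched⇒fixed m uv
    b = P a
    d = P c
    mb : P b ≢ b
    mb = partner-moved m ma
    md : P d ≢ d
    md = partner-moved m mc
    ua : u ≢ a
    ua = allowed⇒≢ g1
    bc : b ≢ c
    bc = ≢-sym c≢b
    d≢v : d ≢ v
    d≢v = moved≢fixed m md fv
    m1 = pairUpᴹ m u a ua g1
    m2 = pairUpᴹ m1 b c bc g2
    m3 = pairUpᴹ m2 d v d≢v g3
    P1 = partner m1
    P2 = partner m2
    mu : ∀ {z} → P z ≢ z → z ≢ u
    mu mz = moved≢fixed m mz fu
    mv : ∀ {z} → P z ≢ z → z ≢ v
    mv mz = moved≢fixed m mz fv
    d≢a : d ≢ a
    d≢a e = c≢b (trans (sym (involutive m c)) (cong P e))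
    b≢d : b ≢ d
    b≢d e = a≢c (trans (sym (involutive m a)) (trans (cong P e) (involutive m c)))
    P1b : P1 b ≡ b
    P1b = pairUp-widowed P u a b (mu mb) ma (inj₂ (involutive m a))
    P1c : P1 c ≡ d
    P1c = pairUp-other P u a c (mu mc) (≢-sym a≢c) (mu md) d≢a
    P1d : P1 d ≡ c
    P1d = trans (pairUp-other P u a d (mu md) d≢a (λ e → mu mc (trans (sym (involutive m c)) e)) (λ e → a≢c (sym (trans (sym (involutive m c)) e)))) (involutive m c)
    P1v : P1 v ≡ v
    P1v = trans (pairUp-other P u a v (≢-sym u≢v) (≢-sym (mv ma)) (λ e → u≢v (trans (sym e) fv)) (λ e → mv ma (trans (sym e) fv))) fv
    P2d : P2 d ≡ d
    P2d = pairUp-widowed P1 b c d (≢-sym b≢d) mc (inj₂ P1d)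
    P2v : P2 v ≡ v
    P2v = trans (pairUp-other P1 b c v (≢-sym (mv mb)) (≢-sym (mv mc)) (λ e → mv mb (sym (trans (sym P1v) e))) (λ e → mv mc (sym (trans (sym P1v) e)))) P1v
    keep : ∀ z → P z ≢ z → partner m3 z ≢ z
    keep z mz with ≡-or-≢ z d
    ... | inj₁ refl = pairUp-moves-a P2 (involutive m2) z v d≢v
    ... | inj₂ zd with ≡-or-≢ z b
    ... | inj₁ refl = pairUp-keeps-moved P2 (involutive m2) d v d≢v z (pairUp-moves-a P1 (involutive m1) z c bc)
                        (λ e → zd (trans e P2d)) (λ e → mv mz (trans e P2v))
    ... | inj₂ zb = pairUp-keeps-moved P2 (involutive m2) d v d≢v z
          (pairUp-keeps-moved P1 (involutive m1) b c bc z
            (pairUp-keeps-moved P (involutive m) u a ua z mz (λ e → mu mz (trans e fu)) zb)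
            (λ e → zb (trans e P1b)) (λ e → zd (trans e P1c)))
          (λ e → zd (trans e P2d)) (λ e → mv mz (trans e P2v))
    hitu : partner m3 u ≢ u
    hitu = pairUp-keeps-moved P2 (involutive m2) d v d≢v u
          (pairUp-keeps-moved P1 (involutive m1) b c bc u (pairUp-moves-a P (involutive m) u a ua)
            (λ e → mu mb (sym (trans e P1b))) (λ e → mu md (sym (trans e P1c))))
          (λ e → mu md (sym (trans e P2d))) (λ e → u≢v (trans e P2v))

module ExtremalConfigurations {n : ℕ} (X : Fin n → Bool) (B : Fin n → Fin n → Bool) (Δ : ℕ) where
  LargeClique : Set
  LargeClique = Σ (Fin n → Bool) λ I → (I ⊆ᵇ X) × (count I ≡ suc Δ) × (∀ x y → I x ≡ true → I y ≡ true → x ≢ y → B x y ≡ true)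

  OddBipartite : Set
  OddBipartite = Σ (Fin n → Bool) λ U → (U ⊆ᵇ X) × (count U ≡ Δ) × (count (λ x → X x ∧ not (U x)) ≡ Δ) ×
         (∀ x y → X x ≡ true → X y ≡ true → B x y ≡ (U x xor U y)) × Σ ℕ (λ c → Δ ≡ suc (c * 2))

  Extremal : Set
  Extremal = (count X ≡ Δ + Δ) × (LargeClique ⊎ OddBipartite)

module BoundedDegree {n : ℕ} (X : Fin n → Bool) (B : Fin n → Fin n → Bool)
  (Bsym : ∀ x y → B x y ≡ B y x) (Birr : ∀ x → B x x ≡ false) (Δ : ℕ)
  (degb : ∀ x → X x ≡ true → count (λ y → X y ∧ B x y) ≤ Δ) where

  open Allowed X B Bsym public

  size≤allowed-degree+Δ+1 : ∀ x → X x ≡ true → count X ≤ count (allowed x) + Δ + 1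
  size≤allowed-degree+Δ+1 x x∈X = begin
    count X                                                  ≤⟨ sum-mono-≤ cover ⟩
    sum (λ y → indicator (allowed x y) + indicator (X y ∧ B x y) + indicator (x == y))
                                                             ≡⟨ ∑-distrib-+ (λ y → indicator (allowed x y) + indicator (X y ∧ B x y))
                                                                            (λ y → indicator (x == y)) ⟩
    sum (λ y → indicator (allowed x y) + indicator (X y ∧ B x y)) + count (x ==_)
                                                             ≡⟨ cong₂ _+_ (∑-distrib-+ (indicator ∘ allowed x) (λ y → indicator (X y ∧ B x y)))
                                                                          (trans (count-cong (==-sym x)) (count-== x)) ⟩
    count (allowed x) + count (λ y → X y ∧ B x y) + 1       ≤⟨ +-monoˡ-≤ 1 (+-monoʳ-≤ (count (allowed x)) (degb x x∈X)) ⟩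
    count (allowed x) + Δ + 1                                ∎
    where
    open ≤-Reasoning
    cover : ∀ y → indicator (X y) ≤ indicator (allowed x y) + indicator (X y ∧ B x y) + indicator (x == y)
    cover y rewrite x∈X with X y | x == y | B x y
    ... | true  | true  | true  = s≤s z≤n
    ... | true  | true  | false = s≤s z≤n
    ... | true  | false | true  = s≤s z≤n
    ... | true  | false | false = s≤s z≤n
    ... | false | _     | _     = z≤n

  size≡moved+unmatched : (m : Matching) → count X ≡ count (moved m) + count (unmatched m)
  size≡moved+unmatched m = trans (count-split X (moved m)) (cong₂ _+_ (count-cong e1) (count-cong e2))
    where
    e1 : ∀ y → (X y ∧ moved m y) ≡ moved m y
    e1 y with ≡-or-≢ (partner m y) y
    ... | inj₁ e rewrite e | ==-refl y | ∧-comm (X y) false = refl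
    ... | inj₂ ne rewrite ≢⇒==-false ne | moved⇒∈X m ne = refl
    e2 : ∀ y → (X y ∧ not (moved m y)) ≡ unmatched m y
    e2 y rewrite not-involutive (partner m y == y) = refl

  record Stuck (m : Matching) (u v : Fin n) : Set where
    field
      size≡2Δ : count X ≡ Δ + Δ
      only-u-v-unmatched : ∀ y → unmatched m y ≡ true → y ≡ u ⊎ y ≡ v
      alternating : ∀ y → partner m y ≢ y → indicator (allowed u y) + indicator (allowed v (partner m y)) ≡ 1
      deg-u : suc (count (allowed u)) ≡ Δ
      deg-v : suc (count (allowed v)) ≡ Δ
      u-v-forbidden : allowed u v ≡ false

  -- Each matching edge {y, partner y} carries at most one allowed neighbour of u or v at its
  -- two ends (otherwise a path of length 3 augments), and u, v have at most Δ forbidden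
  -- neighbours each.
  stuck : (m : Matching) (u v : Fin n) → u ≢ v → unmatched m u ≡ true → unmatched m v ≡ true → Δ + Δ ≤ count X →
    allowed u v ≡ false →
    (∀ w → (allowed u w ∧ unmatched m w) ≡ false) → (∀ w → (allowed v w ∧ unmatched m w) ≡ false) →
    (∀ x → (allowed u x ∧ allowed v (partner m x)) ≡ false) → Stuck m u v
  stuck m u v u≢v uu uv hΔ u-v-forbidden n1 n2 n3 = record
    { size≡2Δ = proj₁ (proj₂ ar) ; only-u-v-unmatched = only ; alternating = Tf ; deg-u = proj₁ (proj₂ (proj₂ (proj₂ ar)))
    ; deg-v = proj₂ (proj₂ (proj₂ (proj₂ ar))) ; u-v-forbidden = u-v-forbidden }
    where
    P = partner m
    f = λ y → indicator (allowed u y) + indicator (allowed v (P y))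
    mx : ∀ {y w} → allowed y w ≡ true → (allowed y w ∧ unmatched m w) ≡ false → P w ≢ w
    mx {y} {w} g e fw = not-¬ (subst (λ z → (z ∧ unmatched m w) ≡ true) (sym g) (unmatched-intro m (allowed-∈ʳ g) fw)) e
    pw : ∀ y → f y ≤ indicator (moved m y)
    pw y with ≡-or-≢ (P y) y
    ... | inj₁ fy rewrite fy | ==-refl y = ≤-reflexive (cong₂ _+_ (cong indicator (g1 (allowed u y) refl)) (cong indicator (g2 (allowed v y) refl)))
      where
      g1 : ∀ b → allowed u y ≡ b → b ≡ false
      g1 true e = ⊥-elim (mx {u} {y} e (n1 y) fy)
      g1 false e = refl
      g2 : ∀ b → allowed v y ≡ b → b ≡ false
      g2 true e = ⊥-elim (mx {v} {y} e (n2 y) fy)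
      g2 false e = refl
    ... | inj₂ ny rewrite ≢⇒==-false ny = lem (allowed u y) (allowed v (P y)) (n3 y)
      where
      lem : ∀ a b → (a ∧ b) ≡ false → indicator a + indicator b ≤ 1
      lem true true ()
      lem true false e = s≤s z≤n
      lem false true e = s≤s z≤n
      lem false false e = z≤n
    du = count (allowed u)
    dv = count (allowed v)
    sumf : sum f ≡ du + dv
    sumf = trans (∑-distrib-+ (λ y → indicator (allowed u y)) (λ y → indicator (allowed v (P y)))) (cong (du +_) (count-∘-involution P (involutive m) (allowed v)))
    h1 : du + dv ≤ count (moved m)
    h1 = subst (_≤ count (moved m)) sumf (sum-mono-≤ pw)
    un2 : 2 ≤ count (unmatched m)
    un2 = subst (2 ≤_) (sym (count-remove (unmatched m) u uu)) (s≤s (count-≥1 (remove (unmatched m) u) v (∧-intro uv (cong not (≢⇒==-false (≢-sym u≢v))))))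
    ar = tight-counts du dv (count (moved m)) (count (unmatched m)) (count X) Δ h1 (size≡moved+unmatched m) un2
           (size≤allowed-degree+Δ+1 u (unmatched⇒∈X m uu)) (size≤allowed-degree+Δ+1 v (unmatched⇒∈X m uv)) hΔ
    tot : sum f ≡ count (moved m)
    tot = trans sumf (proj₁ (proj₂ (proj₂ ar)))
    Tf : ∀ y → P y ≢ y → f y ≡ 1
    Tf y ny = trans (sum-mono-tight pw (≤-reflexive (sym tot)) y) (cong indicator (cong not (≢⇒==-false ny)))
    only : ∀ y → unmatched m y ≡ true → y ≡ u ⊎ y ≡ v
    only y uy with ≡-or-≢ y u
    ... | inj₁ e = inj₁ e
    ... | inj₂ yu with ≡-or-≢ y v
    ... | inj₁ e = inj₂ e
    ... | inj₂ yv = ⊥-elim (<-irrefl refl (≤-trans three (≤-reflexive (proj₁ ar))))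
      where
      r1 = remove (unmatched m) u
      three : 3 ≤ count (unmatched m)
      three = subst (3 ≤_) (sym (count-remove (unmatched m) u uu))
        (s≤s (subst (2 ≤_) (sym (count-remove r1 v (∧-intro uv (cong not (≢⇒==-false (≢-sym u≢v))))))
          (s≤s (count-≥1 (remove r1 v) y (∧-intro (∧-intro uy (cong not (≢⇒==-false yu))) (cong not (≢⇒==-false yv)))))))

  open ExtremalConfigurations X B Δ public

  indicator-sum≡1 : ∀ a b → indicator a + indicator b ≡ 1 → (a ≡ true → b ≡ false) × (a ≡ false → b ≡ true)
  indicator-sum≡1 true true ()
  indicator-sum≡1 true false e = (λ _ → refl) , (λ ())
  indicator-sum≡1 false true e = (λ ()) , (λ _ → refl)
  indicator-sum≡1 false false ()

  indicator-sum≡1′ : ∀ a b → indicator a + indicator b ≡ 1 → (b ≡ false → a ≡ true) × (b ≡ true → a ≡ false)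
  indicator-sum≡1′ true true ()
  indicator-sum≡1′ true false e = (λ _ → refl) , (λ ())
  indicator-sum≡1′ false true e = (λ ()) , (λ _ → refl)
  indicator-sum≡1′ false false ()

  Stuck-swap : ∀ {m u v} → Stuck m u v → Stuck m v u
  Stuck-swap {m} {u} {v} t = record { size≡2Δ = size≡2Δ ; only-u-v-unmatched = λ y e → swap (only-u-v-unmatched y e) ; alternating = alternating′ ; deg-u = deg-v ; deg-v = deg-u
     ; u-v-forbidden = trans (allowed-sym v u) u-v-forbidden }
    where
    open Stuck t
    swap : ∀ {y} → y ≡ u ⊎ y ≡ v → y ≡ v ⊎ y ≡ u
    swap (inj₁ e) = inj₂ e
    swap (inj₂ e) = inj₁ e
    alternating′ : ∀ y → partner m y ≢ y → indicator (allowed v y) + indicator (allowed u (partner m y)) ≡ 1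
    alternating′ y ny = trans (+-comm (indicator (allowed v y)) _) (subst (λ z → indicator (allowed u (partner m y)) + indicator (allowed v z) ≡ 1) (involutive m y) (alternating (partner m y) (partner-moved m ny)))

  module StuckAt (m : Matching) (u v : Fin n) (u≢v : u ≢ v) (uu : unmatched m u ≡ true) (uv : unmatched m v ≡ true) (t : Stuck m u v) where
    open Stuck t
    P = partner m
    fu = unmatched⇒fixed m uu
    fv = unmatched⇒fixed m uv

    alternating′ : ∀ y → P y ≢ y → indicator (allowed u (P y)) + indicator (allowed v y) ≡ 1
    alternating′ y ny = subst (λ z → indicator (allowed u (P y)) + indicator (allowed v z) ≡ 1) (involutive m y) (alternating (P y) (partner-moved m ny))

    moved-unless-u-v : ∀ y → X y ≡ true → y ≢ u → y ≢ v → P y ≢ y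
    moved-unless-u-v y ex yu yv fy with only-u-v-unmatched y (unmatched-intro m ex fy)
    ... | inj₁ e = yu e
    ... | inj₂ e = yv e

    u-neighbour-moved : ∀ {y} → allowed u y ≡ true → P y ≢ y
    u-neighbour-moved {y} g = moved-unless-u-v y (allowed-∈ʳ g) (λ e → allowed⇒≢ g (sym e)) (λ e → not-¬ (subst (λ z → allowed u z ≡ true) e g) u-v-forbidden)

    common-neighbour-case : (x : Fin n) → allowed u x ≡ true → allowed v x ≡ true → (q : Fin n) →
      allowed u q ≡ true → allowed v q ≡ false → Improvement m
    common-neighbour-case x gux gvx q guq gvq = go
      where
      mx = u-neighbour-moved gux
      y = P x
      my : P y ≢ y
      my = partner-moved m mx
      Px : P y ≡ x
      Px = involutive m x
      guy : allowed u y ≡ false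
      guy with true-or-false (allowed u y)
      ... | inj₂ e = e
      ... | inj₁ e = ⊥-elim (not-¬ gvx (proj₁ (indicator-sum≡1 _ _ (alternating′ x mx)) e))
      gvy : allowed v y ≡ false
      gvy = proj₁ (indicator-sum≡1 _ _ (alternating x mx)) gux
      zM : ∀ {z} → allowed y z ≡ true → P z ≢ z
      zM {z} g = moved-unless-u-v z (allowed-∈ʳ g) (λ e → not-¬ (trans (allowed-sym u y) (subst (λ w → allowed y w ≡ true) e g)) guy)
                              (λ e → not-¬ (trans (allowed-sym v y) (subst (λ w → allowed y w ≡ true) e g)) gvy)
      go : Improvement m
      go with search (λ z → allowed y z ∧ allowed u (P z))
      ... | inj₁ (z , e) = augment₅ m u (P z) y v u≢v uu uv (partner-moved m mz) my a≢c c≢b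
                              g1 (subst (λ w → allowed w y ≡ true) (sym (involutive m z)) (trans (allowed-sym z y) gyz))
                              (subst (λ w → allowed w v ≡ true) (sym Px) (trans (allowed-sym x v) gvx))
        where
        gyz = ∧-conicalˡ (allowed y z) _ e
        g1 = ∧-conicalʳ (allowed y z) _ e
        mz = zM gyz
        a≢c : P z ≢ y
        a≢c e' = not-¬ (subst (λ w → allowed u w ≡ true) e' g1) guy
        c≢b : y ≢ P (P z)
        c≢b e' = allowed⇒≢ gyz (trans e' (involutive m z))
      ... | inj₂ n1 with search (λ z → allowed y z ∧ allowed v (P z))
      ... | inj₁ (z , e) = augment₅ m v (P z) y u (≢-sym u≢v) uv uu (partner-moved m mz) my a≢c c≢b
                              g1 (subst (λ w → allowed w y ≡ true) (sym (involutive m z)) (trans (allowed-sym z y) gyz))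
                              (subst (λ w → allowed w u ≡ true) (sym Px) (trans (allowed-sym x u) gux))
        where
        gyz = ∧-conicalˡ (allowed y z) _ e
        g1 = ∧-conicalʳ (allowed y z) _ e
        mz = zM gyz
        a≢c : P z ≢ y
        a≢c e' = not-¬ (subst (λ w → allowed v w ≡ true) e' g1) gvy
        c≢b : y ≢ P (P z)
        c≢b e' = allowed⇒≢ gyz (trans e' (involutive m z))
      ... | inj₂ n2 = ⊥-elim (degree-gap-impossible (count (allowed y)) (count (allowed u)) Δ (subst (_≤ count (allowed y) + Δ + 1) size≡2Δ lb) st deg-u)
        where
        sub : allowed y ⊆ᵇ allowed u
        sub z g = proj₁ (indicator-sum≡1′ _ _ (alternating z (zM g))) (lemf (n2 z))
          where
          lemf : (allowed y z ∧ allowed v (P z)) ≡ false → allowed v (P z) ≡ false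
          lemf e rewrite g = e
        gyq : allowed y q ≡ false
        gyq with true-or-false (allowed y q)
        ... | inj₂ e = e
        ... | inj₁ g = ⊥-elim (not-¬ (proj₂ (indicator-sum≡1 _ _ (alternating′ q (zM g))) (lemf (n1 q))) gvq)
          where
          lemf : (allowed y q ∧ allowed u (P q)) ≡ false → allowed u (P q) ≡ false
          lemf e rewrite g = e
        st : suc (count (allowed y)) ≤ count (allowed u)
        st = count-mono-< sub q guq gyq
        lb : count X ≤ count (allowed y) + Δ + 1
        lb = size≤allowed-degree+Δ+1 y (moved⇒∈X m my)

    clique-case : (∀ z → allowed u z ≡ allowed v z) → Improvement m ⊎ LargeClique
    clique-case eq with search₂ (λ y y' → I y ∧ (I y' ∧ allowed y y'))
      where
      I : Fin n → Bool
      I z = X z ∧ not (allowed u z)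
    ... | inj₁ (y , y' , e) = inj₁ (augment₅ m u (P y) y' v u≢v uu uv (partner-moved m my) my' a≢c c≢b g1 g2 g3)
      where
      I : Fin n → Bool
      I z = X z ∧ not (allowed u z)
      Iy = ∧-conicalˡ (I y) _ e
      Iy' = ∧-conicalˡ (I y') _ (∧-conicalʳ (I y) _ e)
      g = ∧-conicalʳ (I y') _ (∧-conicalʳ (I y) _ e)
      nuy : allowed u y ≡ false
      nuy = not-injective (∧-conicalʳ (X y) _ Iy)
      nuy' : allowed u y' ≡ false
      nuy' = not-injective (∧-conicalʳ (X y') _ Iy')
      yu : y ≢ u
      yu e = not-¬ (subst (λ w → allowed w y' ≡ true) e g) nuy'
      yv : y ≢ v
      yv e = not-¬ (subst (λ w → allowed w y' ≡ true) e g) (trans (sym (eq y')) nuy')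
      y'u : y' ≢ u
      y'u e = not-¬ (subst (λ w → allowed w y ≡ true) e (trans (allowed-sym y' y) g)) nuy
      y'v : y' ≢ v
      y'v e = not-¬ (subst (λ w → allowed w y ≡ true) e (trans (allowed-sym y' y) g)) (trans (sym (eq y)) nuy)
      my = moved-unless-u-v y (allowed-∈ˡ g) yu yv
      my' = moved-unless-u-v y' (allowed-∈ʳ g) y'u y'v
      g1 : allowed u (P y) ≡ true
      g1 = proj₁ (indicator-sum≡1′ _ _ (alternating′ y my)) (trans (sym (eq y)) nuy)
      gv' : allowed v (P y') ≡ true
      gv' = trans (sym (eq (P y'))) (proj₁ (indicator-sum≡1′ _ _ (alternating′ y' my')) (trans (sym (eq y')) nuy'))
      a≢c : P y ≢ y'
      a≢c e' = not-¬ (subst (λ w → allowed u w ≡ true) e' g1) nuy'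
      c≢b : y' ≢ P (P y)
      c≢b e' = allowed⇒≢ g (sym (trans e' (involutive m y)))
      g2 : allowed (P (P y)) y' ≡ true
      g2 = subst (λ w → allowed w y' ≡ true) (sym (involutive m y)) g
      g3 : allowed (P y') v ≡ true
      g3 = trans (allowed-sym (P y') v) gv'
    ... | inj₂ none = inj₂ (I , (λ z e → ∧-conicalˡ (X z) _ e) , cI , Bc)
      where
      I : Fin n → Bool
      I z = X z ∧ not (allowed u z)
      e1 : ∀ z → (X z ∧ allowed u z) ≡ allowed u z
      e1 z with true-or-false (allowed u z)
      ... | inj₁ q rewrite q | allowed-∈ʳ q = refl
      ... | inj₂ q rewrite q = ∧-comm (X z) false
      cI : count I ≡ suc Δ
      cI = complement≡suc (count (allowed u)) (count I) Δ (trans (cong (_+ count I) (sym (count-cong e1))) (trans (sym (count-split X (allowed u))) size≡2Δ)) deg-u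
      Bc : ∀ x y → I x ≡ true → I y ≡ true → x ≢ y → B x y ≡ true
      Bc x y Ix Iy ne = ¬allowed⇒edge (∧-conicalˡ (X x) _ Ix) (∧-conicalˡ (X y) _ Iy) ne lem
        where
        lem : allowed x y ≡ false
        lem with none x y
        ... | q rewrite Ix | Iy = q

    all-edges-to-side : ∀ x (Sx : Fin n → Bool) → Sx ⊆ᵇ X → count Sx ≡ Δ → X x ≡ true →
      (∀ z → Sx z ≡ true → B x z ≡ true) →
            ∀ y → X y ≡ true → Sx y ≡ false → B x y ≡ false
    all-edges-to-side x Sx SX cS ex hS y ey Sy with true-or-false (B x y)
    ... | inj₂ e = e
    ... | inj₁ e = ⊥-elim (<-irrefl refl (≤-trans (subst (λ w → suc w ≤ _) cS
           (count-mono-< {f = Sx} {g = λ z → X z ∧ B x z} (λ z sz → ∧-intro (SX z sz) (hS z sz)) y (∧-intro ey e) Sy)) (degb x ex)))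

    module NoCommonNeighbour (noc : ∀ z → (allowed u z ∧ allowed v z) ≡ false) where
      clos : ∀ y → allowed u y ≡ true → allowed u (P y) ≡ true
      clos y g = proj₁ (indicator-sum≡1′ _ _ (alternating′ y (u-neighbour-moved g))) (lem (noc y))
        where
        lem : (allowed u y ∧ allowed v y) ≡ false → allowed v y ≡ false
        lem e rewrite g = e
      U : Fin n → Bool
      U z = (z == u) ∨ allowed u z
      UX : U ⊆ᵇ X
      UX z e with true-or-false (z == u)
      ... | inj₁ q = subst (λ w → X w ≡ true) (sym (==⇒≡ q)) (unmatched⇒∈X m uu)
      ... | inj₂ q rewrite q = allowed-∈ʳ e
      Ufalse : ∀ {z} → U z ≡ false → (z ≢ u) × (allowed u z ≡ false)
      Ufalse {z} e = ==-false⇒≢ (∨-conicalˡ (z == u) _ e) , ∨-conicalʳ (z == u) _ e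
      Vchar : ∀ z → X z ≡ true → U z ≡ false → z ≡ v ⊎ (P z ≢ z × allowed v z ≡ true)
      Vchar z ex uz with ≡-or-≢ z v
      ... | inj₁ e = inj₁ e
      ... | inj₂ zv = inj₂ (mz , proj₂ (indicator-sum≡1 _ _ (alternating′ z mz)) nu)
        where
        mz = moved-unless-u-v z ex (proj₁ (Ufalse uz)) zv
        nu : allowed u (P z) ≡ false
        nu with true-or-false (allowed u (P z))
        ... | inj₂ q = q
        ... | inj₁ q = ⊥-elim (not-¬ (subst (λ w → allowed u w ≡ true) (involutive m z) (clos (P z) q)) (proj₂ (Ufalse uz)))
      result : Improvement m ⊎ OddBipartite
      result with search₂ (λ x z → U x ∧ ((X z ∧ not (U z)) ∧ allowed x z))
      ... | inj₁ (x , z , e) = inj₁ (aug x z Ux Xz Uz gxz)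
        where
        Ux = ∧-conicalˡ (U x) _ e
        r1 = ∧-conicalʳ (U x) _ e
        Xz = ∧-conicalˡ (X z) _ (∧-conicalˡ (X z ∧ not (U z)) _ r1)
        Uz = not-injective (∧-conicalʳ (X z) _ (∧-conicalˡ (X z ∧ not (U z)) _ r1))
        gxz = ∧-conicalʳ (X z ∧ not (U z)) _ r1
        aug : ∀ x z → U x ≡ true → X z ≡ true → U z ≡ false → allowed x z ≡ true → Improvement m
        aug x z Ux Xz Uz gxz with true-or-false (x == u)
        ... | inj₁ q = ⊥-elim (not-¬ (subst (λ w → allowed w z ≡ true) (==⇒≡ q) gxz) (proj₂ (Ufalse Uz)))
        ... | inj₂ q with Vchar z Xz Uz
        ... | inj₁ refl = ⊥-elim (not-¬ (∧-intro {allowed u x} {allowed v x} gux (trans (allowed-sym v x) gxz)) (noc x))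
          where
          gux : allowed u x ≡ true
          gux = subst (λ w → w ∨ allowed u x ≡ true) q Ux
        ... | inj₂ (mz , gvz) = augment₅ m u (P x) z v u≢v uu uv (partner-moved m mx) mz a≢c c≢b (clos x gux) g2 g3
          where
          gux : allowed u x ≡ true
          gux = subst (λ w → w ∨ allowed u x ≡ true) q Ux
          mx = u-neighbour-moved gux
          a≢c : P x ≢ z
          a≢c e' = not-¬ (subst (λ w → allowed u w ≡ true) e' (clos x gux)) (proj₂ (Ufalse Uz))
          c≢b : z ≢ P (P x)
          c≢b e' = allowed⇒≢ gxz (sym (trans e' (involutive m x)))
          g2 : allowed (P (P x)) z ≡ true
          g2 = subst (λ w → allowed w z ≡ true) (sym (involutive m x)) gxz
          UPz : U (P z) ≡ false
          UPz with true-or-false (U (P z))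
          ... | inj₂ r = r
          ... | inj₁ r with true-or-false (P z == u)
          ... | inj₁ r2 = ⊥-elim (partner-moved m mz (trans (cong P (==⇒≡ r2)) (trans fu (sym (==⇒≡ r2)))))
          ... | inj₂ r2 = ⊥-elim (not-¬ (subst (λ w → allowed u w ≡ true) (involutive m z) (clos (P z) (subst (λ w → w ∨ allowed u (P z) ≡ true) r2 r))) (proj₂ (Ufalse Uz)))
          g3 : allowed (P z) v ≡ true
          g3 with Vchar (P z) (moved⇒∈X m (partner-moved m mz)) UPz
          ... | inj₁ r = ⊥-elim (partner-moved m mz (trans (cong P r) (trans fv (sym r))))
          ... | inj₂ (_ , r) = trans (allowed-sym (P z) v) r
      ... | inj₂ none = inj₂ (U , UX , cU , cV , Bx , odd)
        where
        cross : ∀ x z → U x ≡ true → X z ≡ true → U z ≡ false → B x z ≡ true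
        cross x z Ux Xz Uz = ¬allowed⇒edge (UX x Ux) Xz (λ e → not-¬ (subst (λ w → U w ≡ true) e Ux) Uz) lem
          where
          lem : allowed x z ≡ false
          lem with none x z
          ... | q rewrite Ux | Xz | Uz = q
        e1 : ∀ z → (U z ∧ (z == u)) ≡ (z == u)
        e1 z with z == u
        ... | true = refl
        ... | false = ∧-comm (allowed u z) false
        e2 : ∀ z → (U z ∧ not (z == u)) ≡ allowed u z
        e2 z with ≡-or-≢ z u
        ... | inj₁ refl = trans (cong (λ b → U z ∧ not b) (==-refl z)) (trans (∧-comm (U z) false) (sym (allowed-irrefl z)))
        ... | inj₂ ne rewrite ≢⇒==-false ne = ∧-identityʳ (allowed u z)
        cU : count U ≡ Δ
        cU = trans (count-split U (λ z → z == u)) (trans (cong₂ _+_ (trans (count-cong e1) (count-== u)) (count-cong e2)) deg-u)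
        e3 : ∀ z → (X z ∧ U z) ≡ U z
        e3 z with true-or-false (U z)
        ... | inj₁ q rewrite q | UX z q = refl
        ... | inj₂ q rewrite q = ∧-comm (X z) false
        cV : count (λ x → X x ∧ not (U x)) ≡ Δ
        cV = +-cancelˡ-≡ Δ _ _ (trans (cong (_+ count (λ x → X x ∧ not (U x))) (sym (trans (count-cong e3) cU))) (trans (sym (count-split X U)) size≡2Δ))
        Bx : ∀ x y → X x ≡ true → X y ≡ true → B x y ≡ (U x xor U y)
        Bx x y ex ey with true-or-false (U x) | true-or-false (U y)
        ... | inj₁ ux | inj₁ uy rewrite ux | uy = same
          where
          same : B x y ≡ false
          same with ≡-or-≢ x y
          ... | inj₁ refl = Birr x
          ... | inj₂ ne = all-edges-to-side x (λ z → X z ∧ not (U z)) (λ z e → ∧-conicalˡ (X z) _ e) cV ex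
                   (λ z e → cross x z ux (∧-conicalˡ (X z) _ e) (not-injective (∧-conicalʳ (X z) _ e))) y ey (lemV)
            where
            lemV : (X y ∧ not (U y)) ≡ false
            lemV rewrite uy | ∧-comm (X y) false = refl
        ... | inj₁ ux | inj₂ uy rewrite ux | uy = cross x y ux ey uy
        ... | inj₂ ux | inj₁ uy rewrite ux | uy = trans (Bsym x y) (cross y x uy ex ux)
        ... | inj₂ ux | inj₂ uy rewrite ux | uy = same
          where
          same : B x y ≡ false
          same with ≡-or-≢ x y
          ... | inj₁ refl = Birr x
          ... | inj₂ ne = all-edges-to-side x U UX cU ex (λ z e → trans (Bsym x z) (cross z x e ex ux)) y ey uy
        q : Fin n → Fin n
        q z = if allowed u z then P z else z
        qinv : Involutive _≡_ q
        qinv z with true-or-false (allowed u z)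
        ... | inj₁ g rewrite g | clos z g = involutive m z
        ... | inj₂ g rewrite g | g = refl
        qm : ∀ z → not (q z == z) ≡ allowed u z
        qm z with true-or-false (allowed u z)
        ... | inj₁ g rewrite g | ≢⇒==-false (u-neighbour-moved g) = refl
        ... | inj₂ g rewrite g | ==-refl z = refl
        odd : Σ ℕ (λ c → Δ ≡ suc (c * 2))
        odd = count (λ x → x <ᶠ q x) , trans (sym deg-u) (cong suc (trans (sym (count-cong qm)) (trans (count-moved≡2*ascents q qinv) (*-comm 2 (count (λ x → x <ᶠ q x))))))

    bipartite-case : (∀ z → (allowed u z ∧ allowed v z) ≡ false) → Improvement m ⊎ OddBipartite
    bipartite-case noc = result
      where open NoCommonNeighbour noc

  stuck⇒improvement⊎extremal : (m : Matching) (u v : Fin n) → u ≢ v → unmatched m u ≡ true →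
    unmatched m v ≡ true → Stuck m u v → Improvement m ⊎ Extremal
  stuck⇒improvement⊎extremal m u v u≢v uu uv t with search (λ x → allowed u x ∧ allowed v x)
  ... | inj₂ noc = mapE (StuckAt.bipartite-case m u v u≢v uu uv t noc)
    where
    mapE : Improvement m ⊎ OddBipartite → Improvement m ⊎ Extremal
    mapE (inj₁ a) = inj₁ a
    mapE (inj₂ b) = inj₂ (Stuck.size≡2Δ t , inj₂ b)
  ... | inj₁ (x , e) with search (λ q → allowed u q ∧ not (allowed v q))
  ... | inj₁ (q , e') = inj₁ (StuckAt.common-neighbour-case m u v u≢v uu uv t x (∧-conicalˡ (allowed u x) _ e) (∧-conicalʳ (allowed u x) _ e) q (∧-conicalˡ (allowed u q) _ e') (not-injective (∧-conicalʳ (allowed u q) _ e')))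
  ... | inj₂ na with search (λ q → allowed v q ∧ not (allowed u q))
  ... | inj₁ (q , e') = inj₁ (StuckAt.common-neighbour-case m v u (≢-sym u≢v) uv uu (Stuck-swap t) x (∧-conicalʳ (allowed u x) _ e) (∧-conicalˡ (allowed u x) _ e) q (∧-conicalˡ (allowed v q) _ e') (not-injective (∧-conicalʳ (allowed v q) _ e')))
  ... | inj₂ nb = mapE (StuckAt.clique-case m u v u≢v uu uv t eq)
    where
    mapE : Improvement m ⊎ LargeClique → Improvement m ⊎ Extremal
    mapE (inj₁ a) = inj₁ a
    mapE (inj₂ b) = inj₂ (Stuck.size≡2Δ t , inj₁ b)
    eq : ∀ z → allowed u z ≡ allowed v z
    eq z with na z | nb z
    ... | h1 | h2 with allowed u z | allowed v z
    ... | true | true = refl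
    ... | false | false = refl
    ... | true | false = ⊥-elim (not-¬ refl h1)
    ... | false | true = ⊥-elim (not-¬ refl h2)

  improvement⊎extremal : (m : Matching) (u v : Fin n) → u ≢ v → unmatched m u ≡ true → unmatched m v ≡ true →
    Δ + Δ ≤ count X → Improvement m ⊎ Extremal
  improvement⊎extremal m u v u≢v uu uv hΔ with true-or-false (allowed u v)
  ... | inj₁ g = inj₁ (augment₁ m u v uu uv g)
  ... | inj₂ u-v-forbidden with search (λ w → allowed u w ∧ unmatched m w)
  ... | inj₁ (w , e) = inj₁ (augment₁ m u w uu (∧-conicalʳ (allowed u w) _ e) (∧-conicalˡ (allowed u w) _ e))
  ... | inj₂ n1 with search (λ w → allowed v w ∧ unmatched m w)
  ... | inj₁ (w , e) = inj₁ (augment₁ m v w uv (∧-conicalʳ (allowed v w) _ e) (∧-conicalˡ (allowed v w) _ e))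
  ... | inj₂ n2 with search (λ x → allowed u x ∧ allowed v (partner m x))
  ... | inj₁ (x , e) = inj₁ (augment₃ m u v x u≢v uu uv mx g1 (∧-conicalʳ (allowed u x) _ e))
    where
    g1 = ∧-conicalˡ (allowed u x) _ e
    mx : partner m x ≢ x
    mx fx = not-¬ (∧-intro {allowed u x} g1 (unmatched-intro m (allowed-∈ʳ g1) fx)) (n1 x)
  ... | inj₂ n3 = stuck⇒improvement⊎extremal m u v u≢v uu uv (stuck m u v u≢v uu uv hΔ u-v-forbidden n1 n2 n3)

  PerfectMatching : Set
  PerfectMatching = Σ Matching λ m → ∀ x → X x ≡ true → partner m x ≢ x

  perfectMatching-fuel : (h : ℕ) → count X ≡ h * 2 → Δ + Δ ≤ count X → (fuel : ℕ) (m : Matching) →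
    count (unmatched m) ≤ fuel → PerfectMatching ⊎ Extremal
  perfectMatching-fuel h ev hΔ fuel m hf with search (unmatched m)
  ... | inj₂ none = inj₁ (m , λ x ex fx → not-¬ (unmatched-intro m ex fx) (none x))
  ... | inj₁ (u , uu) = go
    where
    c = count (λ x → x <ᶠ partner m x)
    par : count (moved m) ≡ c * 2
    par = trans (count-moved≡2*ascents (partner m) (involutive m)) (*-comm 2 c)
    rest1 : 1 ≤ count (remove (unmatched m) u)
    rest1 with count (remove (unmatched m) u) in eq
    ... | suc _ = s≤s z≤n
    ... | zero = ⊥-elim (even≢odd h c (trans (*-comm 2 h) (trans (sym ev) (trans (size≡moved+unmatched m) (trans (cong₂ _+_ par (trans (count-remove (unmatched m) u uu) (cong suc eq))) (trans (+-comm (c * 2) 1) (cong suc (*-comm c 2))))))))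
    v∃ = count-witness (remove (unmatched m) u) rest1
    v = proj₁ v∃
    uv = ∧-conicalˡ (unmatched m v) _ (proj₂ v∃)
    v≢u : v ≢ u
    v≢u = ==-false⇒≢ (not-injective (∧-conicalʳ (unmatched m v) _ (proj₂ v∃)))
    go : PerfectMatching ⊎ Extremal
    go with improvement⊎extremal m u v (≢-sym v≢u) uu uv hΔ
    ... | inj₂ ex = inj₂ ex
    ... | inj₁ (m' , sub , w , uw , nw) = next fuel hf
      where
      st : suc (count (unmatched m')) ≤ count (unmatched m)
      st = count-mono-< sub w uw nw
      next : (f : ℕ) → count (unmatched m) ≤ f → PerfectMatching ⊎ Extremal
      next zero hf' = ⊥-elim (<-irrefl refl (≤-trans st (≤-trans hf' z≤n)))
      next (suc f) hf' = perfectMatching-fuel h ev hΔ f m' (≤-pred (≤-trans st hf'))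

  emptyMatching : Matching
  emptyMatching = mkMatching (λ x → x) (λ _ → refl) (λ x ne → ⊥-elim (ne refl))

  perfectMatching⊎extremal : (h : ℕ) → count X ≡ h * 2 → Δ + Δ ≤ count X → PerfectMatching ⊎ Extremal
  perfectMatching⊎extremal h ev hΔ = perfectMatching-fuel h ev hΔ n emptyMatching (count≤n (unmatched emptyMatching))

record DisjointPerfectMatchings {n : ℕ} (X : Fin n → Bool) (B : Fin n → Fin n → Bool) (k : ℕ) : Set where
  field
    pm : Fin k → Fin n → Fin n
    pm-involutive : ∀ i → Involutive _≡_ (pm i)
    pm-moves : ∀ i x → X x ≡ true → pm i x ≢ x
    pm-fixes : ∀ i x → X x ≡ false → pm i x ≡ x
    pm-avoids : ∀ i x → X x ≡ true → B x (pm i x) ≡ false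
    pm-disjoint : ∀ i j → i ≢ j → ∀ x → X x ≡ true → pm i x ≢ pm j x

module Switching {n : ℕ} (X : Fin n → Bool) (B : Fin n → Fin n → Bool) (Bsym : ∀ x y → B x y ≡ B y x) where
  open Allowed X B Bsym

  Switched : Matching → Fin n → Fin n → Set
  Switched m a b = Σ Matching λ m' → (partner m' a ≡ b) × (partner m' b ≡ a) × (partner m' (partner m a) ≡ partner m b) × (partner m' (partner m b) ≡ partner m a) ×
      (∀ x → x ≢ a → x ≢ b → x ≢ partner m a → x ≢ partner m b → partner m' x ≡ partner m x)

  switch : (m : Matching) (a b : Fin n) → partner m a ≢ a → partner m b ≢ b → a ≢ b → b ≢ partner m a →
    allowed a b ≡ true → allowed (partner m a) (partner m b) ≡ true → Switched m a b
  switch m a b ma mb ab bpa g1 g2 = m2 , v1 , v2 , v3 , v4 , v5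
    where
    P = partner m
    pab : P a ≢ P b
    pab e = ab (trans (sym (involutive m a)) (trans (cong P e) (involutive m b)))
    m1 = pairUpᴹ m a b ab g1
    m2 = pairUpᴹ m1 (P a) (P b) pab g2
    P1 = partner m1
    apb : a ≢ P b
    apb e = bpa (trans (sym (involutive m b)) (cong P (sym e)))
    P1a : P1 a ≡ b
    P1a = pairUp-a P a b
    P1b : P1 b ≡ a
    P1b = pairUp-b P a b ab
    v1 : partner m2 a ≡ b
    v1 = trans (pairUp-other P1 (P a) (P b) a (λ e → ma (sym e)) apb (λ e → bpa (trans (sym P1a) e)) (λ e → mb (sym (trans (sym P1a) e)))) P1a
    v2 : partner m2 b ≡ a
    v2 = trans (pairUp-other P1 (P a) (P b) b bpa (λ e → mb (sym e)) (λ e → ma (sym (trans (sym P1b) e))) (λ e → apb (trans (sym P1b) e))) P1b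
    v3 : partner m2 (P a) ≡ P b
    v3 = pairUp-a P1 (P a) (P b)
    v4 : partner m2 (P b) ≡ P a
    v4 = pairUp-b P1 (P a) (P b) pab
    v5 : ∀ x → x ≢ a → x ≢ b → x ≢ P a → x ≢ P b → partner m2 x ≡ P x
    pinj : ∀ {x y} → P x ≡ P y → x ≡ y
    pinj {x} {y} e = trans (sym (involutive m x)) (trans (cong P e) (involutive m y))
    v5 x xa xb xpa xpb = trans (pairUp-other P1 (P a) (P b) x xpa xpb (λ e → xa (pinj (trans (sym e') e))) (λ e → xb (pinj (trans (sym e') e)))) e'
      where
      e' : P1 x ≡ P x
      e' = pairUp-other P a b x xa xb (λ e → xpa (trans (sym (involutive m x)) (cong P e))) (λ e → xpb (trans (sym (involutive m x)) (cong P e)))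

module ExtremalCase {n : ℕ} (X : Fin n → Bool) (B : Fin n → Fin n → Bool)
  (Bsym : ∀ x y → B x y ≡ B y x) (Birr : ∀ x → B x x ≡ false) (Δ : ℕ)
  (degb : ∀ x → X x ≡ true → count (λ y → X y ∧ B x y) ≤ Δ) where

  open BoundedDegree X B Bsym Birr Δ degb
  open Switching X B Bsym

  perfectMatching-properties : (m : Matching) → (∀ x → X x ≡ true → partner m x ≢ x) →
    (∀ x → X x ≡ false → partner m x ≡ x) × (∀ x → X x ≡ true → B x (partner m x) ≡ false)
  perfectMatching-properties m mv = fx , (λ x ex → allowed⇒non-edge (respects m x (mv x ex)))
    where
    fx : ∀ x → X x ≡ false → partner m x ≡ x
    fx x nx with ≡-or-≢ (partner m x) x
    ... | inj₁ e = e
    ... | inj₂ ne = ⊥-elim (not-¬ (moved⇒∈X m ne) nx)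

  twoDisjoint : (m1 m2 : Matching) → (∀ x → X x ≡ true → partner m1 x ≢ x) →
    (∀ x → X x ≡ true → partner m2 x ≢ x) →
        (∀ x → X x ≡ true → partner m1 x ≢ partner m2 x) → DisjointPerfectMatchings X B 2
  twoDisjoint m1 m2 mv1 mv2 dis = record { pm = Q ; pm-involutive = qi ; pm-moves = qm ; pm-fixes = qf ; pm-avoids = qb ; pm-disjoint = qd }
    where
    Q : Fin 2 → Fin n → Fin n
    Q fz = partner m1
    Q (fs _) = partner m2
    f1 = perfectMatching-properties m1 mv1
    f2 = perfectMatching-properties m2 mv2
    qi : ∀ i → Involutive _≡_ (Q i)
    qi fz = involutive m1
    qi (fs fz) = involutive m2
    qm : ∀ i x → X x ≡ true → Q i x ≢ x
    qm fz = mv1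
    qm (fs fz) = mv2
    qf : ∀ i x → X x ≡ false → Q i x ≡ x
    qf fz = proj₁ f1
    qf (fs fz) = proj₁ f2
    qb : ∀ i x → X x ≡ true → B x (Q i x) ≡ false
    qb fz = proj₂ f1
    qb (fs fz) = proj₂ f2
    qd : ∀ i j → i ≢ j → ∀ x → X x ≡ true → Q i x ≢ Q j x
    qd fz fz ne = ⊥-elim (ne refl)
    qd fz (fs fz) ne = dis
    qd (fs fz) fz ne x ex e = dis x ex (sym e)
    qd (fs fz) (fs fz) ne = ⊥-elim (ne refl)

  withMatching : PerfectMatching → Fin n → Fin n → Bool
  withMatching M x y = B x y ∨ (not (x == y) ∧ (partner (proj₁ M) x == y))

  withMatching-sym : (M : PerfectMatching) → ∀ x y → withMatching M x y ≡ withMatching M y x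
  withMatching-sym (m , _) x y rewrite Bsym x y | ==-sym x y | involution-== (partner m) (involutive m) x y = refl

  withMatching-irrefl : (M : PerfectMatching) → ∀ x → withMatching M x x ≡ false
  withMatching-irrefl M x rewrite Birr x | ==-refl x = refl

  withMatching-degree : (M : PerfectMatching) → ∀ x → X x ≡ true → count (λ y → X y ∧ withMatching M x y) ≤ suc Δ
  withMatching-degree M@(m , _) x x∈X = begin
    count (λ y → X y ∧ withMatching M x y)            ≤⟨ count-mono old-or-partner ⟩
    count (λ y → (X y ∧ B x y) ∨ (y == partner m x))  ≤⟨ count-∨ (λ y → X y ∧ B x y) (_== partner m x) ⟩
    count (λ y → X y ∧ B x y) + count (_== partner m x) ≤⟨ +-mono-≤ (degb x x∈X) (≤-reflexive (count-== (partner m x))) ⟩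
    Δ + 1                                             ≡⟨ +-comm Δ 1 ⟩
    suc Δ                                             ∎
    where
    open ≤-Reasoning
    old-or-partner : ∀ y → (X y ∧ withMatching M x y) ≡ true → ((X y ∧ B x y) ∨ (y == partner m x)) ≡ true
    old-or-partner y e with X y | B x y
    ... | true  | true  = refl
    ... | true  | false = subst (λ b → (false ∨ b) ≡ true) (==-sym (partner m x) y) (∧-conicalʳ (not (x == y)) _ e)
    ... | false | _     = ⊥-elim (not-¬ e refl)

  extend : (M : PerfectMatching) → ∀ {k} → DisjointPerfectMatchings X (withMatching M) k →
    DisjointPerfectMatchings X B (suc k)
  extend M {k} K = record { pm = Q ; pm-involutive = qi ; pm-moves = qm ; pm-fixes = qf ; pm-avoids = qb ; pm-disjoint = qd }
    where
    m0 = proj₁ M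
    P = partner m0
    fm = perfectMatching-properties m0 (proj₂ M)
    open DisjointPerfectMatchings K renaming (pm to pm′; pm-involutive to pm-involutive′; pm-moves to pm-moves′; pm-fixes to pm-fixes′; pm-avoids to pm-avoids′; pm-disjoint to pm-disjoint′)
    Q : Fin (suc k) → Fin n → Fin n
    Q fz = P
    Q (fs i) = pm′ i
    qi : ∀ i → Involutive _≡_ (Q i)
    qi fz = involutive m0
    qi (fs i) = pm-involutive′ i
    qm : ∀ i x → X x ≡ true → Q i x ≢ x
    qm fz = proj₂ M
    qm (fs i) = pm-moves′ i
    qf : ∀ i x → X x ≡ false → Q i x ≡ x
    qf fz = proj₁ fm
    qf (fs i) = pm-fixes′ i
    qb : ∀ i x → X x ≡ true → B x (Q i x) ≡ false
    qb fz = proj₂ fm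
    qb (fs i) x ex = ∨-conicalˡ (B x (pm′ i x)) _ (pm-avoids′ i x ex)
    d0 : ∀ j x → X x ≡ true → P x ≢ pm′ j x
    d0 j x ex e = not-¬ (∧-intro {not (x == pm′ j x)} (cong not (≢⇒==-false (λ e' → pm-moves′ j x ex (sym e'))))
                     (subst (λ w → (P x == w) ≡ true) e (==-refl (P x)))) (∨-conicalʳ (B x (pm′ j x)) _ (pm-avoids′ j x ex))
    qd : ∀ i j → i ≢ j → ∀ x → X x ≡ true → Q i x ≢ Q j x
    qd fz fz ne = ⊥-elim (ne refl)
    qd fz (fs j) ne = d0 j
    qd (fs i) fz ne x ex e = d0 i x ex (sym e)
    qd (fs i) (fs j) ne = pm-disjoint′ i j (λ e → ne (cong fs e))

  -- Adding M to B produced an extremal configuration for B ∪ M (with |X| = 2Δ + 2); two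
  -- matchings avoiding B are then obtained by exchanging two edges of M.
  module _ (M : PerfectMatching) (NX : count X ≡ suc Δ + suc Δ) (Δ1 : 1 ≤ Δ) where
    m0 = proj₁ M
    P = partner m0
    allm = proj₂ M

    B' : Fin n → Fin n → Bool
    B' = withMatching M

    degX : ∀ x → X x ≡ true → suc Δ ≤ count (allowed x)
    degX x ex = double≤⇒≤ Δ (count (allowed x)) (subst (_≤ count (allowed x) + Δ + 1) NX (size≤allowed-degree+Δ+1 x ex))

    pinj : ∀ {x y} → P x ≡ P y → x ≡ y
    pinj {x} {y} e = trans (sym (involutive m0 x)) (trans (cong P e) (involutive m0 y))

    B'→P : ∀ {x y} → allowed x y ≡ true → B' x y ≡ true → P x ≡ y
    B'→P {x} {y} g e rewrite allowed⇒non-edge g = ==⇒≡ (∧-conicalʳ (not (x == y)) _ e)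

    PX : ∀ x → X x ≡ true → X (P x) ≡ true
    PX x ex = moved⇒∈X m0 (λ e → allm x ex (pinj e))

    module CliqueCase (I : Fin n → Bool) (IX : I ⊆ᵇ X) (cI : count I ≡ suc (suc Δ))
        (BI : ∀ x y → I x ≡ true → I y ≡ true → x ≢ y → B' x y ≡ true) where
      S : Fin n → Bool
      S z = X z ∧ not (I z)
      SX : S ⊆ᵇ X
      SX z e = ∧-conicalˡ (X z) _ e
      e3 : ∀ z → (X z ∧ I z) ≡ I z
      e3 z with true-or-false (I z)
      ... | inj₁ q rewrite q | IX z q = refl
      ... | inj₂ q rewrite q = ∧-comm (X z) false
      cS : count S ≡ Δ
      cS = complement≡Δ Δ (count S) (trans (cong (_+ count S) (sym (trans (count-cong e3) cI))) (trans (sym (count-split X I)) NX))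
      IS : ∀ {y z} → I y ≡ true → S z ≡ true → y ≢ z
      IS {y} Iy Sz refl = not-¬ Iy (not-injective (∧-conicalʳ (X y) _ Sz))
      Sintro : ∀ {z} → X z ≡ true → I z ≡ false → S z ≡ true
      Sintro ex nI rewrite ex | nI = refl
      Ifalse : ∀ {z} → S z ≡ true → I z ≡ false
      Ifalse {z} e = not-injective (∧-conicalʳ (X z) _ e)
      R : Fin n → Fin n → Bool
      R x y = S y ∨ (y == P x)
      allowed⊆R : ∀ x → I x ≡ true → allowed x ⊆ᵇ R x
      allowed⊆R x Ix y g with true-or-false (I y)
      ... | inj₁ Iy = subst (λ w → (S y ∨ w) ≡ true) (sym (==-sym-true (B'→P g (BI x y Ix Iy (allowed⇒≢ g))))) (or-r' (S y))
        where
        ==-sym-true : P x ≡ y → (y == P x) ≡ true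
        ==-sym-true e rewrite e = ==-refl y
        or-r' : ∀ b → (b ∨ true) ≡ true
        or-r' true = refl
        or-r' false = refl
      ... | inj₂ nI rewrite Sintro (allowed-∈ʳ g) nI = refl
      cR : ∀ x → count (R x) ≤ suc Δ
      cR x = ≤-trans (count-∨ S (λ y → y == P x)) (≤-reflexive (trans (cong₂ _+_ cS (count-== (P x))) (+-comm Δ 1)))
      S⊆allowed : ∀ x → I x ≡ true → S ⊆ᵇ allowed x
      S⊆allowed x Ix z Sz = count-⊆-full (allowed⊆R x Ix) (≤-trans (cR x) (degX x (IX x Ix))) z (subst (λ b → b ≡ true) refl (orl Sz))
        where orl : ∀ {a b} → a ≡ true → (a ∨ b) ≡ true
              orl refl = refl
      IP : ∀ x → I x ≡ true → I (P x) ≡ true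
      IP x Ix with true-or-false (I (P x))
      ... | inj₁ q = q
      ... | inj₂ q = ⊥-elim (<-irrefl refl (≤-trans (degX x (IX x Ix)) (≤-trans (count-mono sub) (≤-reflexive cS))))
        where
        sub : allowed x ⊆ᵇ S
        sub y g with true-or-false (S y) | allowed⊆R x Ix y g
        ... | inj₁ s | _ = s
        ... | inj₂ s | r = ⊥-elim (not-¬ (subst (λ w → S w ≡ true) (sym (==⇒≡ (∨r {S y} s r))) (Sintro (PX x (IX x Ix)) q)) s)
          where
          ∨r : ∀ {a b} → a ≡ false → (a ∨ b) ≡ true → b ≡ true
          ∨r refl e = e
      SP : ∀ z → S z ≡ true → S (P z) ≡ true
      SP z Sz with true-or-false (I (P z))
      ... | inj₁ q = ⊥-elim (not-¬ (subst (λ w → I w ≡ true) (involutive m0 z) (IP (P z) q)) (Ifalse Sz))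
      ... | inj₂ q = Sintro (PX z (SX z Sz)) q
      opaque
        a∃ : Σ (Fin n) λ x → I x ≡ true
        a∃ = count-witness I (subst (1 ≤_) (sym cI) (s≤s z≤n))
      a = proj₁ a∃
      Ia = proj₂ a∃
      opaque
        s∃ : Σ (Fin n) λ x → S x ≡ true
        s∃ = count-witness S (subst (1 ≤_) (sym cS) Δ1)
      s = proj₁ s∃
      Ss = proj₂ s∃
      ma = allm a (IX a Ia)
      ms = allm s (SX s Ss)
      IPa = IP a Ia
      SPs = SP s Ss
      opaque
        dl : Switched m0 a s
        dl = switch m0 a s ma ms (IS Ia Ss) (λ e → IS IPa Ss (sym e)) (S⊆allowed a Ia s Ss) (S⊆allowed (P a) IPa (P s) SPs)
      M1 : Matching
      M1 = proj₁ dl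
      P1 = partner M1
      d1 : P1 a ≡ s
      d1 = proj₁ (proj₂ dl)
      d2 : P1 s ≡ a
      d2 = proj₁ (proj₂ (proj₂ dl))
      d3 : P1 (P a) ≡ P s
      d3 = proj₁ (proj₂ (proj₂ (proj₂ dl)))
      d4 : P1 (P s) ≡ P a
      d4 = proj₁ (proj₂ (proj₂ (proj₂ (proj₂ dl))))
      d5 : ∀ x → x ≢ a → x ≢ s → x ≢ P a → x ≢ P s → P1 x ≡ P x
      d5 = proj₂ (proj₂ (proj₂ (proj₂ (proj₂ dl))))
      I₀ = remove (remove I a) (P a)
      I₀I : ∀ {z} → I₀ z ≡ true → I z ≡ true
      I₀I {z} e = ∧-conicalˡ (I z) _ (∧-conicalˡ (remove I a z) _ e)
      I₀a : ∀ {z} → I₀ z ≡ true → z ≢ a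
      I₀a {z} e = ==-false⇒≢ (not-injective (∧-conicalʳ (I z) _ (∧-conicalˡ (remove I a z) _ e)))
      I₀pa : ∀ {z} → I₀ z ≡ true → z ≢ P a
      I₀pa {z} e = ==-false⇒≢ (not-injective (∧-conicalʳ (remove I a z) _ e))
      cI₀ : count I₀ ≡ Δ
      cI₀ = suc-injective (suc-injective (trans (sym (cong suc (count-remove (remove I a) (P a) (∧-intro IPa (cong not (≢⇒==-false (λ e → ma e))))))) (trans (sym (count-remove I a Ia)) cI)))
      opaque
        σr : Σ Matching λ σ → (∀ x → I₀ x ∨ S x ≡ false → partner σ x ≡ partner emptyMatching x) × (∀ x → I₀ x ≡ true → S (partner σ x) ≡ true) × (∀ x → S x ≡ true → I₀ (partner σ x) ≡ true)
        σr = matchAcross Δ I₀ S cI₀ cS (λ x e → lem x e) (λ x y i₀ sy → S⊆allowed x (I₀I i₀) y sy) emptyMatching (λ _ _ → refl)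
          where
          lem : ∀ x → I₀ x ≡ true → S x ≡ false
          lem x e with true-or-false (S x)
          ... | inj₁ sx = ⊥-elim (IS (I₀I e) sx refl)
          ... | inj₂ sx = sx
      σ = proj₁ σr
      σI = proj₁ (proj₂ (proj₂ σr))
      σS = proj₂ (proj₂ (proj₂ σr))
      apa : a ≢ P a
      apa e = ma (sym e)
      M2 = pairUpᴹ σ a (P a) apa (respects m0 a ma)
      P2 = partner M2
      σI≢ : ∀ {z} → I₀ z ≡ true → (partner σ z ≢ a) × (partner σ z ≢ P a)
      σI≢ e = (λ q → IS Ia (σI _ e) (sym q)) , (λ q → IS IPa (σI _ e) (sym q))
      σS≢ : ∀ {z} → S z ≡ true → (partner σ z ≢ a) × (partner σ z ≢ P a)
      σS≢ e = (λ q → I₀a (σS _ e) q) , (λ q → I₀pa (σS _ e) q)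
      cls : ∀ x → X x ≡ true → (x ≡ a) ⊎ (x ≡ P a) ⊎ (I₀ x ≡ true) ⊎ (S x ≡ true)
      cls x ex with ≡-or-≢ x a
      ... | inj₁ e = inj₁ e
      ... | inj₂ xa with ≡-or-≢ x (P a)
      ... | inj₁ e = inj₂ (inj₁ e)
      ... | inj₂ xpa with true-or-false (I x)
      ... | inj₁ Ix = inj₂ (inj₂ (inj₁ (∧-intro (∧-intro Ix (cong not (≢⇒==-false xa))) (cong not (≢⇒==-false xpa)))))
      ... | inj₂ nI = inj₂ (inj₂ (inj₂ (Sintro ex nI)))
      P2I₀ : ∀ {x} → I₀ x ≡ true → P2 x ≡ partner σ x
      P2I₀ {x} e = pairUp-other (partner σ) a (P a) x (I₀a e) (I₀pa e) (proj₁ (σI≢ e)) (proj₂ (σI≢ e))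
      P2S : ∀ {x} → S x ≡ true → P2 x ≡ partner σ x
      P2S {x} e = pairUp-other (partner σ) a (P a) x (λ q → IS Ia e (sym q)) (λ q → IS IPa e (sym q)) (proj₁ (σS≢ e)) (proj₂ (σS≢ e))
      P2a : P2 a ≡ P a
      P2a = pairUp-a (partner σ) a (P a)
      P2pa : P2 (P a) ≡ a
      P2pa = pairUp-b (partner σ) a (P a) apa
      mv2 : ∀ x → X x ≡ true → P2 x ≢ x
      mv2 x ex with cls x ex
      ... | inj₁ refl rewrite P2a = ma
      ... | inj₂ (inj₁ refl) rewrite P2pa = apa
      ... | inj₂ (inj₂ (inj₁ e)) rewrite P2I₀ e = λ q → IS (I₀I e) (σI x e) (sym q)
      ... | inj₂ (inj₂ (inj₂ e)) rewrite P2S e = λ q → IS (I₀I (σS x e)) e q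
      mv1 : ∀ x → X x ≡ true → P1 x ≢ x
      mv1 x ex with ≡-or-≢ x a
      ... | inj₁ refl rewrite d1 = λ q → IS Ia Ss (sym q)
      ... | inj₂ xa with ≡-or-≢ x s
      ... | inj₁ refl rewrite d2 = IS Ia Ss
      ... | inj₂ xs with ≡-or-≢ x (P a)
      ... | inj₁ refl rewrite d3 = λ q → IS IPa SPs (sym q)
      ... | inj₂ xpa with ≡-or-≢ x (P s)
      ... | inj₁ refl rewrite d4 = IS IPa SPs
      ... | inj₂ xps rewrite d5 x xa xs xpa xps = allm x ex
      dis : ∀ x → X x ≡ true → P1 x ≢ P2 x
      dis x ex with ≡-or-≢ x a
      ... | inj₁ refl rewrite d1 | P2a = λ q → IS IPa Ss (sym q)
      ... | inj₂ xa with ≡-or-≢ x s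
      ... | inj₁ refl rewrite d2 | P2S Ss = λ q → I₀a (σS x Ss) (sym q)
      ... | inj₂ xs with ≡-or-≢ x (P a)
      ... | inj₁ refl rewrite d3 | P2pa = λ q → IS Ia SPs (sym q)
      ... | inj₂ xpa with ≡-or-≢ x (P s)
      ... | inj₁ refl rewrite d4 | P2S SPs = λ q → I₀pa (σS x SPs) (sym q)
      ... | inj₂ xps rewrite d5 x xa xs xpa xps with cls x ex
      ... | inj₁ e = ⊥-elim (xa e)
      ... | inj₂ (inj₁ e) = ⊥-elim (xpa e)
      ... | inj₂ (inj₂ (inj₁ e)) rewrite P2I₀ e = λ q → IS (IP x (I₀I e)) (σI x e) q
      ... | inj₂ (inj₂ (inj₂ e)) rewrite P2S e = λ q → IS (I₀I (σS x e)) (SP x e) (sym q)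

    twoMatchings-clique : (I : Fin n → Bool) → I ⊆ᵇ X → count I ≡ suc (suc Δ) →
      (∀ x y → I x ≡ true → I y ≡ true → x ≢ y → B' x y ≡ true) → DisjointPerfectMatchings X B 2
    twoMatchings-clique I IX cI BI = twoDisjoint M1 M2 mv1 mv2 dis
      where open CliqueCase I IX cI BI

    side-alternates : (W : Fin n → Bool) → W ⊆ᵇ X → count W ≡ suc Δ →
      (∀ x y → X x ≡ true → X y ≡ true → B' x y ≡ (W x xor W y)) →
           ∀ x → W x ≡ true → W (P x) ≡ false
    side-alternates W WX cW BW x Wx with true-or-false (W (P x))
    ... | inj₂ q = q
    ... | inj₁ q = ⊥-elim (<-irrefl refl (≤-trans (degX x (WX x Wx)) (≤-trans (count-mono sub) (≤-reflexive cr))))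
      where
      cr : count (remove W x) ≡ Δ
      cr = suc-injective (trans (sym (count-remove W x Wx)) cW)
      sub : allowed x ⊆ᵇ remove W x
      sub y g with true-or-false (W y)
      ... | inj₁ wy = ∧-intro wy (cong not (≢⇒==-false (λ e → allowed⇒≢ g (sym e))))
      ... | inj₂ wy = ⊥-elim (not-¬ (subst (λ w → W w ≡ true) (B'→P g bxy) q) wy)
        where
        bxy : B' x y ≡ true
        bxy rewrite BW x y (WX x Wx) (allowed-∈ʳ g) | Wx | wy = refl

    module BipartiteCase (U : Fin n → Bool) (UX : U ⊆ᵇ X) (cU : count U ≡ suc Δ) (cV : count (λ x → X x ∧ not (U x)) ≡ suc Δ)
        (BU : ∀ x y → X x ≡ true → X y ≡ true → B' x y ≡ (U x xor U y)) (odd : Σ ℕ (λ c → suc Δ ≡ suc (c * 2))) where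
      c : ℕ
      c = proj₁ odd
      oddc : suc Δ ≡ suc (c * 2)
      oddc = proj₂ odd
      V : Fin n → Bool
      V z = X z ∧ not (U z)
      VX : V ⊆ᵇ X
      VX z e = ∧-conicalˡ (X z) _ e
      xor-not : ∀ a b → (not a xor not b) ≡ (a xor b)
      xor-not true true = refl
      xor-not true false = refl
      xor-not false true = refl
      xor-not false false = refl
      BV : ∀ x y → X x ≡ true → X y ≡ true → B' x y ≡ (V x xor V y)
      BV x y ex ey rewrite ex | ey = trans (BU x y ex ey) (sym (xor-not (U x) (U y)))
      UV : ∀ {y z} → U y ≡ true → V z ≡ true → y ≢ z
      UV {y} Uy Vz refl = not-¬ Uy (not-injective (∧-conicalʳ (X y) _ Vz))
      Vintro : ∀ {z} → X z ≡ true → U z ≡ false → V z ≡ true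
      Vintro ex nU rewrite ex | nU = refl
      Ufl : ∀ {z} → V z ≡ true → U z ≡ false
      Ufl {z} e = not-injective (∧-conicalʳ (X z) _ e)
      UP : ∀ x → U x ≡ true → V (P x) ≡ true
      UP x Ux = Vintro (PX x (UX x Ux)) (side-alternates U UX cU BU x Ux)
      VP : ∀ x → V x ≡ true → U (P x) ≡ true
      VP x Vx with true-or-false (U (P x))
      ... | inj₁ q = q
      ... | inj₂ q = ⊥-elim (not-¬ (Vintro (PX x (VX x Vx)) q) (side-alternates V VX cV BV x Vx))
      cliqU : ∀ x y → U x ≡ true → U y ≡ true → x ≢ y → allowed x y ≡ true
      cliqU x y Ux Uy ne = allowed-intro (UX x Ux) (UX y Uy) ne (∨-conicalˡ (B x y) _ bb)
        where
        bb : B' x y ≡ false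
        bb rewrite BU x y (UX x Ux) (UX y Uy) | Ux | Uy = refl
      cliqV : ∀ x y → V x ≡ true → V y ≡ true → x ≢ y → allowed x y ≡ true
      cliqV x y Vx Vy ne = allowed-intro (VX x Vx) (VX y Vy) ne (∨-conicalˡ (B x y) _ bb)
        where
        bb : B' x y ≡ false
        bb rewrite BV x y (VX x Vx) (VX y Vy) | Vx | Vy = refl
      opaque
        u1∃ : Σ (Fin n) λ x → U x ≡ true
        u1∃ = count-witness U (subst (1 ≤_) (sym cU) (s≤s z≤n))
      u1 = proj₁ u1∃
      Uu1 = proj₂ u1∃
      cU1 : count (remove U u1) ≡ Δ
      cU1 = suc-injective (trans (sym (count-remove U u1 Uu1)) cU)
      opaque
        u2∃ : Σ (Fin n) λ x → remove U u1 x ≡ true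
        u2∃ = count-witness (remove U u1) (subst (1 ≤_) (sym cU1) Δ1)
      u2 = proj₁ u2∃
      Uu2 = ∧-conicalˡ (U u2) _ (proj₂ u2∃)
      u2≢u1 : u2 ≢ u1
      u2≢u1 = ==-false⇒≢ (not-injective (∧-conicalʳ (U u2) _ (proj₂ u2∃)))
      v1 = P u1
      v2 = P u2
      Vv1 = UP u1 Uu1
      Vv2 = UP u2 Uu2
      mu1 = allm u1 (UX u1 Uu1)
      mu2 = allm u2 (UX u2 Uu2)
      opaque
        dl : Switched m0 u1 u2
        dl = switch m0 u1 u2 mu1 mu2 (λ e → u2≢u1 (sym e)) (λ e → UV Uu2 Vv1 e)
               (cliqU u1 u2 Uu1 Uu2 (λ e → u2≢u1 (sym e))) (cliqV v1 v2 Vv1 Vv2 (λ e → u2≢u1 (sym (pinj e))))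
      M1 : Matching
      M1 = proj₁ dl
      P1 = partner M1
      d1 : P1 u1 ≡ u2
      d1 = proj₁ (proj₂ dl)
      d2 : P1 u2 ≡ u1
      d2 = proj₁ (proj₂ (proj₂ dl))
      d3 : P1 (P u1) ≡ P u2
      d3 = proj₁ (proj₂ (proj₂ (proj₂ dl)))
      d4 : P1 (P u2) ≡ P u1
      d4 = proj₁ (proj₂ (proj₂ (proj₂ (proj₂ dl))))
      d5 : ∀ x → x ≢ u1 → x ≢ u2 → x ≢ P u1 → x ≢ P u2 → P1 x ≡ P x
      d5 = proj₂ (proj₂ (proj₂ (proj₂ (proj₂ dl))))
      Δeven : count (remove U u1) ≡ c * 2
      Δeven = trans cU1 (suc-injective oddc)
      cV1 : count (remove V v1) ≡ c * 2
      cV1 = trans (suc-injective (trans (sym (count-remove V v1 Vv1)) cV)) (suc-injective oddc)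
      opaque
        σ1r : Σ Matching λ σ → (∀ x → remove U u1 x ≡ false → partner σ x ≡ partner emptyMatching x) × (∀ x → remove U u1 x ≡ true → remove U u1 (partner σ x) ≡ true × partner σ x ≢ x)
        σ1r = matchWithin c (remove U u1) Δeven (λ x y ex ey ne → cliqU x y (remove-⊆ U u1 ex) (remove-⊆ U u1 ey) ne) emptyMatching (λ _ _ → refl)
      σ1 = proj₁ σ1r
      opaque
        σr : Σ Matching λ σ → (∀ x → remove V v1 x ≡ false → partner σ x ≡ partner σ1 x) × (∀ x → remove V v1 x ≡ true → remove V v1 (partner σ x) ≡ true × partner σ x ≢ x)
        σr = matchWithin c (remove V v1) cV1 (λ x y ex ey ne → cliqV x y (remove-⊆ V v1 ex) (remove-⊆ V v1 ey) ne) σ1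
               (λ x e → proj₁ (proj₂ σ1r) x (remove-false U u1 (Ufl (remove-⊆ V v1 e))))
      σ = proj₁ σr
      σU : ∀ {x} → remove U u1 x ≡ true → (remove U u1 (partner σ x) ≡ true)
      σU {x} e = subst (λ w → remove U u1 w ≡ true) (sym (proj₁ (proj₂ σr) x (remove-false V v1 Vf))) (proj₁ (proj₂ (proj₂ σ1r) x e))
        where
        Vf : V x ≡ false
        Vf with true-or-false (V x)
        ... | inj₁ q = ⊥-elim (UV (remove-⊆ U u1 e) q refl)
        ... | inj₂ q = q
      σU≢ : ∀ {x} → remove U u1 x ≡ true → partner σ x ≢ x
      σU≢ {x} e = subst (λ w → w ≢ x) (sym (proj₁ (proj₂ σr) x (remove-false V v1 Vf))) (proj₂ (proj₂ (proj₂ σ1r) x e))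
        where
        Vf : V x ≡ false
        Vf with true-or-false (V x)
        ... | inj₁ q = ⊥-elim (UV (remove-⊆ U u1 e) q refl)
        ... | inj₂ q = q
      σV : ∀ {x} → remove V v1 x ≡ true → remove V v1 (partner σ x) ≡ true
      σV {x} e = proj₁ (proj₂ (proj₂ σr) x e)
      σV≢ : ∀ {x} → remove V v1 x ≡ true → partner σ x ≢ x
      σV≢ {x} e = proj₂ (proj₂ (proj₂ σr) x e)
      u1v1 : u1 ≢ v1
      u1v1 = UV Uu1 Vv1
      M2 = pairUpᴹ σ u1 v1 u1v1 (respects m0 u1 mu1)
      P2 = partner M2
      P2u1 : P2 u1 ≡ v1
      P2u1 = pairUp-a (partner σ) u1 v1
      P2v1 : P2 v1 ≡ u1
      P2v1 = pairUp-b (partner σ) u1 v1 u1v1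
      P2U : ∀ {x} → remove U u1 x ≡ true → P2 x ≡ partner σ x
      P2U {x} e = pairUp-other (partner σ) u1 v1 x (remove-≢ U u1 e) (λ q → UV (remove-⊆ U u1 e) Vv1 q)
                    (remove-≢ U u1 (σU e)) (λ q → UV (remove-⊆ U u1 (σU e)) Vv1 q)
      P2V : ∀ {x} → remove V v1 x ≡ true → P2 x ≡ partner σ x
      P2V {x} e = pairUp-other (partner σ) u1 v1 x (λ q → UV Uu1 (remove-⊆ V v1 e) (sym q)) (remove-≢ V v1 e)
                    (λ q → UV Uu1 (remove-⊆ V v1 (σV e)) (sym q)) (remove-≢ V v1 (σV e))
      cls : ∀ x → X x ≡ true → (x ≡ u1) ⊎ (x ≡ v1) ⊎ (remove U u1 x ≡ true) ⊎ (remove V v1 x ≡ true)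
      cls x ex with ≡-or-≢ x u1
      ... | inj₁ e = inj₁ e
      ... | inj₂ xu with ≡-or-≢ x v1
      ... | inj₁ e = inj₂ (inj₁ e)
      ... | inj₂ xv with true-or-false (U x)
      ... | inj₁ Ux = inj₂ (inj₂ (inj₁ (∧-intro Ux (cong not (≢⇒==-false xu)))))
      ... | inj₂ nU = inj₂ (inj₂ (inj₂ (∧-intro (Vintro ex nU) (cong not (≢⇒==-false xv)))))
      mv2 : ∀ x → X x ≡ true → P2 x ≢ x
      mv2 x ex with cls x ex
      ... | inj₁ refl rewrite P2u1 = λ q → u1v1 (sym q)
      ... | inj₂ (inj₁ refl) rewrite P2v1 = u1v1
      ... | inj₂ (inj₂ (inj₁ e)) rewrite P2U e = σU≢ e
      ... | inj₂ (inj₂ (inj₂ e)) rewrite P2V e = σV≢ e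
      u1u2 : u1 ≢ u2
      u1u2 e = u2≢u1 (sym e)
      v1v2 : v1 ≢ v2
      v1v2 e = u1u2 (pinj e)
      mv1 : ∀ x → X x ≡ true → P1 x ≢ x
      mv1 x ex with ≡-or-≢ x u1
      ... | inj₁ refl rewrite d1 = λ q → u1u2 (sym q)
      ... | inj₂ xa with ≡-or-≢ x u2
      ... | inj₁ refl rewrite d2 = u1u2
      ... | inj₂ xs with ≡-or-≢ x v1
      ... | inj₁ refl rewrite d3 = λ q → v1v2 (sym q)
      ... | inj₂ xpa with ≡-or-≢ x v2
      ... | inj₁ refl rewrite d4 = v1v2
      ... | inj₂ xps rewrite d5 x xa xs xpa xps = allm x ex
      dis : ∀ x → X x ≡ true → P1 x ≢ P2 x
      dis x ex with ≡-or-≢ x u1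
      ... | inj₁ refl rewrite d1 | P2u1 = λ q → UV Uu2 Vv1 q
      ... | inj₂ xa with ≡-or-≢ x u2
      ... | inj₁ refl rewrite d2 = λ q → remove-≢ U u1 (σU ru2) (trans (sym (P2U ru2)) (sym q))
        where ru2 : remove U u1 x ≡ true
              ru2 = proj₂ u2∃
      ... | inj₂ xs with ≡-or-≢ x v1
      ... | inj₁ refl rewrite d3 | P2v1 = λ q → UV Uu1 Vv2 (sym q)
      ... | inj₂ xpa with ≡-or-≢ x v2
      ... | inj₁ refl rewrite d4 = λ q → remove-≢ V v1 (σV rv2) (trans (sym (P2V rv2)) (sym q))
        where rv2 : remove V v1 x ≡ true
              rv2 = ∧-intro Vv2 (cong not (≢⇒==-false (λ e → v1v2 (sym e))))
      ... | inj₂ xps rewrite d5 x xa xs xpa xps with cls x ex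
      ... | inj₁ e = ⊥-elim (xa e)
      ... | inj₂ (inj₁ e) = ⊥-elim (xpa e)
      ... | inj₂ (inj₂ (inj₁ e)) rewrite P2U e = λ q → UV (remove-⊆ U u1 (σU e)) (UP x (remove-⊆ U u1 e)) (sym q)
      ... | inj₂ (inj₂ (inj₂ e)) rewrite P2V e = λ q → UV (VP x (remove-⊆ V v1 e)) (remove-⊆ V v1 (σV e)) q

    twoMatchings-bipartite : (U : Fin n → Bool) → U ⊆ᵇ X → count U ≡ suc Δ →
      count (λ x → X x ∧ not (U x)) ≡ suc Δ →
      (∀ x y → X x ≡ true → X y ≡ true → B' x y ≡ (U x xor U y)) → Σ ℕ (λ c → suc Δ ≡ suc (c * 2)) → DisjointPerfectMatchings X B 2
    twoMatchings-bipartite U UX cU cV BU odd = twoDisjoint M1 M2 mv1 mv2 dis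
      where open BipartiteCase U UX cU cV BU odd

noMatchings : ∀ {n} (X : Fin n → Bool) (B : Fin n → Fin n → Bool) → DisjointPerfectMatchings X B 0
noMatchings X B = record { pm = λ () ; pm-involutive = λ () ; pm-moves = λ () ; pm-fixes = λ () ; pm-avoids = λ () ; pm-disjoint = λ () }

bound-step : ∀ Δ k N → Δ + Δ + suc (suc k) + suc (suc k) ≤ N + 2 → suc Δ + suc Δ + suc k + suc k ≤ N + 2
bound-step Δ k N h = ≤-trans (≤-reflexive e) h
  where
  e : suc Δ + suc Δ + suc k + suc k ≡ Δ + Δ + suc (suc k) + suc (suc k)
  e = solve (Δ ∷ k ∷ [])

bound⇒2Δ+2≤N : ∀ Δ k N → Δ + Δ + suc (suc k) + suc (suc k) ≤ N + 2 → suc (suc (Δ + Δ)) ≤ N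
bound⇒2Δ+2≤N Δ k N h = +-cancelʳ-≤ 2 _ _ (≤-trans (≤-reflexive e) (≤-trans (m≤m+n (Δ + Δ + 4) (k + k)) (≤-trans (≤-reflexive e2) h)))
  where
  e : suc (suc (Δ + Δ)) + 2 ≡ Δ + Δ + 4
  e = solve (Δ ∷ [])
  e2 : Δ + Δ + 4 + (k + k) ≡ Δ + Δ + suc (suc k) + suc (suc k)
  e2 = solve (Δ ∷ k ∷ [])

bound⇒2Δ≤N : ∀ Δ N → Δ + Δ + 1 + 1 ≤ N + 2 → Δ + Δ ≤ N
bound⇒2Δ≤N Δ N h = +-cancelʳ-≤ 2 _ _ (≤-trans (≤-reflexive e) h)
  where
  e : Δ + Δ + 2 ≡ Δ + Δ + 1 + 1
  e = solve (Δ ∷ [])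

Δ≥1 : ∀ Δ N → N ≡ suc Δ + suc Δ → 2 < N → 1 ≤ Δ
Δ≥1 zero N e h = ⊥-elim (<-irrefl refl (subst (2 <_) e h))
Δ≥1 (suc Δ) N e h = s≤s z≤n

addMatching : ∀ {n} (X : Fin n → Bool) (h : ℕ) → count X ≡ h * 2 → (k : ℕ) (B : Fin n → Fin n → Bool)
  (Bsym : ∀ x y → B x y ≡ B y x) (Birr : ∀ x → B x x ≡ false) (Δ : ℕ)
  (degb : ∀ x → X x ≡ true → count (λ y → X y ∧ B x y) ≤ Δ) →
  Δ + Δ + suc (suc k) + suc (suc k) ≤ count X + 2 → (2 ≤ suc (suc k) → suc (suc k) < count X) →
  ((B' : Fin n → Fin n → Bool) (Bsym' : ∀ x y → B' x y ≡ B' y x) (Birr' : ∀ x → B' x x ≡ false) (Δ' : ℕ)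
     (degb' : ∀ x → X x ≡ true → count (λ y → X y ∧ B' x y) ≤ Δ') →
     Δ' + Δ' + suc k + suc k ≤ count X + 2 → (2 ≤ suc k → suc k < count X) →
     DisjointPerfectMatchings X B' (suc k) ⊎ (suc k ≡ 1 × ExtremalConfigurations.Extremal X B' Δ')) →
  DisjointPerfectMatchings X B (suc (suc k)) ⊎ (suc (suc k) ≡ 1 × ExtremalConfigurations.Extremal X B Δ)
addMatching {n} X h ev k B Bsym Birr Δ degb hk kN rec with BoundedDegree.perfectMatching⊎extremal X B Bsym Birr Δ degb h ev (≤-trans (n≤1+n _) (≤-trans (n≤1+n _) (bound⇒2Δ+2≤N Δ k (count X) hk)))
... | inj₂ (e , _) = ⊥-elim (<⇒≢ (≤-trans (n≤1+n _) (bound⇒2Δ+2≤N Δ k (count X) hk)) (sym e))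
... | inj₁ M with rec (withMatching M) (withMatching-sym M) (withMatching-irrefl M) (suc Δ) (withMatching-degree M)
                    (bound-step Δ k (count X) hk) (λ _ → ≤-trans (n≤1+n _) (kN (s≤s (s≤s z≤n))))
  where open ExtremalCase X B Bsym Birr Δ degb
... | inj₁ K = inj₁ (ExtremalCase.extend X B Bsym Birr Δ degb M K)
... | inj₂ (refl , (NX , inj₁ (I , IX , cI , BI))) =
  inj₁ (ExtremalCase.twoMatchings-clique X B Bsym Birr Δ degb M NX (Δ≥1 Δ (count X) NX (kN (s≤s (s≤s z≤n)))) I IX cI BI)
... | inj₂ (refl , (NX , inj₂ (U , UX , cU , cV , BU , odd))) =
  inj₁ (ExtremalCase.twoMatchings-bipartite X B Bsym Birr Δ degb M NX (Δ≥1 Δ (count X) NX (kN (s≤s (s≤s z≤n)))) U UX cU cV BU odd)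

disjointPerfectMatchings : ∀ {n} (X : Fin n → Bool) (h : ℕ) → count X ≡ h * 2 → (k : ℕ) (B : Fin n → Fin n → Bool)
  (Bsym : ∀ x y → B x y ≡ B y x) (Birr : ∀ x → B x x ≡ false) (Δ : ℕ)
  (degb : ∀ x → X x ≡ true → count (λ y → X y ∧ B x y) ≤ Δ) →
  Δ + Δ + k + k ≤ count X + 2 → (2 ≤ k → k < count X) →
  DisjointPerfectMatchings X B k ⊎ (k ≡ 1 × ExtremalConfigurations.Extremal X B Δ)
disjointPerfectMatchings X h ev zero B Bsym Birr Δ degb hk kN = inj₁ (noMatchings X B)
disjointPerfectMatchings X h ev (suc zero) B Bsym Birr Δ degb hk kN with BoundedDegree.perfectMatching⊎extremal X B Bsym Birr Δ degb h ev (bound⇒2Δ≤N Δ (count X) hk)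
... | inj₂ ex = inj₂ (refl , ex)
... | inj₁ M = inj₁ (ExtremalCase.extend X B Bsym Birr Δ degb M (noMatchings X _))
disjointPerfectMatchings X h ev (suc (suc k)) B Bsym Birr Δ degb hk kN = addMatching X h ev k B Bsym Birr Δ degb hk kN (disjointPerfectMatchings X h ev (suc k))

∣∣≡count : ∀ {n} (v : Vec Bool n) → ∣ v ∣ ≡ count (lookup v)
∣∣≡count Vec.[] = refl
∣∣≡count (true Vec.∷ v) = cong suc (∣∣≡count v)
∣∣≡count (false Vec.∷ v) = ∣∣≡count v

∣tabulate∣≡count : ∀ {n} (f : Fin n → Bool) → ∣ tabulate f ∣ ≡ count f
∣tabulate∣≡count f = trans (∣∣≡count (tabulate f)) (count-cong (lookup∘tabulate f))

deg≡count : ∀ {n} (G : Graph n) (v : Fin n) → deg G v ≡ count (adj G v)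
deg≡count G v = ∣tabulate∣≡count (adj G v)

∈⇒lookup : ∀ {n} {S : Subset n} {x} → x ∈ S → lookup S x ≡ true
∈⇒lookup = []=⇒lookup

lookup⇒∈ : ∀ {n} {S : Subset n} {x} → lookup S x ≡ true → x ∈ S
lookup⇒∈ {S = S} {x} = lookup⇒[]= x S

≤-foldr-⊔ : ∀ (xs : List ℕ) {a} → a LM.∈ xs → a ≤ foldr _⊔_ 0 xs
≤-foldr-⊔ (x ∷ xs) (here refl) = m≤m⊔n x _
≤-foldr-⊔ (x ∷ xs) (there a∈xs) = ≤-trans (≤-foldr-⊔ xs a∈xs) (m≤n⊔m x _)

deg≤maxDeg : ∀ {n} (G : Graph n) (v : Fin n) → deg G v ≤ maxDeg G
deg≤maxDeg {n} G v = ≤-foldr-⊔ (map (deg G) (allFin n)) (∈-map⁺ (deg G) (∈-allFin v))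

neighbours-in≤maxDeg : ∀ {n} (G : Graph n) (S : Fin n → Bool) x → count (λ y → S y ∧ adj G x y) ≤ maxDeg G
neighbours-in≤maxDeg G S x = begin
  count (λ y → S y ∧ adj G x y)  ≤⟨ count-mono {g = adj G x} (λ y → ∧-conicalʳ (S y) _) ⟩
  count (adj G x)                ≡⟨ deg≡count G x ⟨
  deg G x                        ≤⟨ deg≤maxDeg G x ⟩
  maxDeg G                       ∎
  where open ≤-Reasoning

length-elems : ∀ {n} (S : Subset n) → length (elems S) ≡ ∣ S ∣
length-elems Vec.[] = refl
length-elems (true Vec.∷ S) = cong suc (trans (Data.List.Properties.length-map fs (elems S)) (length-elems S))
  where import Data.List.Properties
length-elems (false Vec.∷ S) = trans (Data.List.Properties.length-map fs (elems S)) (length-elems S)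
  where import Data.List.Properties

elems-⊆ : ∀ {n} (S : Subset n) → All (λ x → lookup S x ≡ true) (elems S)
elems-⊆ Vec.[] = All.[]
elems-⊆ (true Vec.∷ S) = refl All.∷ AllP.map⁺ (Data.List.Relation.Unary.All.map (λ e → e) (elems-⊆ S))
elems-⊆ (false Vec.∷ S) = AllP.map⁺ (Data.List.Relation.Unary.All.map (λ e → e) (elems-⊆ S))

map-const : ∀ {A : Set} (f : A → ℕ) (k : ℕ) (xs : List A) → All (λ x → f x ≡ k) xs →
  map f xs ≡ replicate (length xs) k
map-const f k [] All.[] = refl
map-const f k (x ∷ xs) (e All.∷ es) = cong₂ _∷_ e (map-const f k xs es)

record Enumeration {n} (S : Fin n → Bool) (m : ℕ) : Set where
  field
    elem      : Fin m → Fin n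
    injective : Injective _≡_ _≡_ elem
    member    : ∀ i → S (elem i) ≡ true
    onto      : ∀ x → S x ≡ true → Σ (Fin m) λ i → elem i ≡ x

enumerate : ∀ {n} (S : Fin n → Bool) (m : ℕ) → count S ≡ m → Enumeration S m
enumerate {zero} S zero _ = record { elem = λ () ; injective = λ {i} → ⊥-elim (FP.¬Fin0 i) ; member = λ () ; onto = λ () }
enumerate {suc n} S m c with S fz in S0
enumerate {suc n} S zero () | true
enumerate {suc n} S (suc m) c | true = record
  { elem = elem′ ; injective = injective′ ; member = member′ ; onto = onto′ }
  where
  open Enumeration (enumerate (S ∘ fs) m (suc-injective c))
  elem′ : Fin (suc m) → Fin (suc n)
  elem′ fz     = fz
  elem′ (fs i) = fs (elem i)
  injective′ : Injective _≡_ _≡_ elem′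
  injective′ {fz}   {fz}   _  = refl
  injective′ {fs i} {fs j} eq = cong fs (injective (FP.suc-injective eq))
  member′ : ∀ i → S (elem′ i) ≡ true
  member′ fz     = S0
  member′ (fs i) = member i
  onto′ : ∀ x → S x ≡ true → Σ (Fin (suc m)) λ i → elem′ i ≡ x
  onto′ fz     _  = fz , refl
  onto′ (fs x) Sx = let (i , eq) = onto x Sx in fs i , cong fs eq
enumerate {suc n} S m c | false = record
  { elem = fs ∘ elem ; injective = injective ∘ FP.suc-injective ; member = member ; onto = onto′ }
  where
  open Enumeration (enumerate (S ∘ fs) m c)
  onto′ : ∀ x → S x ≡ true → Σ (Fin m) λ i → fs (elem i) ≡ x
  onto′ fz     Sx = ⊥-elim (not-¬ Sx S0)
  onto′ (fs x) Sx = let (i , eq) = onto x Sx in i , cong fs eq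

count-∨-disjoint : ∀ {n} (f g : Fin n → Bool) → (∀ x → (f x ∧ g x) ≡ false) →
  count (λ x → f x ∨ g x) ≡ count f + count g
count-∨-disjoint f g d = trans (sum-cong-≗ (λ x → lem (f x) (g x) (d x))) (∑-distrib-+ (indicator ∘ f) (indicator ∘ g))
  where
  lem : ∀ a b → (a ∧ b) ≡ false → indicator (a ∨ b) ≡ indicator a + indicator b
  lem true true ()
  lem true false e = refl
  lem false b e = refl

anyᵇ-witness : ∀ {k} (f : Fin k → Bool) → anyᵇ f ≡ true → Σ (Fin k) λ i → f i ≡ true
anyᵇ-witness {suc k} f e with f fz in e0
... | true = fz , e0
... | false = let (i , q) = anyᵇ-witness (f ∘ fs) e in fs i , q

anyᵇ-intro : ∀ {k} (f : Fin k → Bool) (i : Fin k) → f i ≡ true → anyᵇ f ≡ true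
anyᵇ-intro f fz e rewrite e = refl
anyᵇ-intro f (fs i) e with f fz
... | true = refl
... | false = anyᵇ-intro (f ∘ fs) i e

count-image : ∀ {n k} (g : Fin k → Fin n) → Injective _≡_ _≡_ g → count (λ v → anyᵇ (λ i → g i == v)) ≡ k
count-image {n} {zero} g inj = count-none {n} (λ v → false) (λ _ → refl)
count-image {n} {suc k} g inj = trans (count-∨-disjoint (λ v → g fz == v) (λ v → anyᵇ (λ i → g (fs i) == v)) dis)
  (cong₂ _+_ (trans (count-cong (λ v → ==-sym (g fz) v)) (count-== (g fz))) (count-image (g ∘ fs) (λ q → FP.suc-injective (inj q))))
  where
  dis : ∀ v → ((g fz == v) ∧ anyᵇ (λ i → g (fs i) == v)) ≡ false
  dis v with true-or-false (g fz == v)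
  ... | inj₂ e rewrite e = refl
  ... | inj₁ e with true-or-false (anyᵇ (λ i → g (fs i) == v))
  ... | inj₂ e2 rewrite e | e2 = refl
  ... | inj₁ e2 = ⊥-elim (let (i , q) = anyᵇ-witness (λ i → g (fs i) == v) e2 in fz≢fs (inj (trans (==⇒≡ e) (sym (==⇒≡ q)))))
    where
    fz≢fs : ∀ {m} {j : Fin m} → fz ≢ fs j
    fz≢fs ()

[b+j*2]/2≡j : ∀ j b → b < 2 → (b + j * 2) / 2 ≡ j
[b+j*2]/2≡j j b b<2 = trans (+-distrib-/ b (j * 2) lt') (trans (cong₂ _+_ (m<n⇒m/n≡0 b<2) (m*n/n≡m j 2)) refl)
  where
  lt' : b % 2 + (j * 2) % 2 < 2
  lt' = subst (_< 2) (sym (trans (cong₂ _+_ (m<n⇒m%n≡m b<2) (m*n%n≡0 j 2)) (+-identityʳ b))) b<2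

[b+j*2]%2≡b : ∀ j b → b < 2 → (b + j * 2) % 2 ≡ b
[b+j*2]%2≡b j b b<2 = trans ([m+kn]%n≡m%n b j 2) (m<n⇒m%n≡m b<2)

b+j*2<2*Δ : ∀ Δ j b → j < Δ → b < 2 → b + j * 2 < 2 * Δ
b+j*2<2*Δ Δ j b j<Δ b<2 = ≤-trans (s≤s (+-monoˡ-≤ (j * 2) (≤-pred b<2))) (≤-trans (*-monoˡ-≤ 2 j<Δ) (≤-reflexive (*-comm Δ 2)))

/2< : ∀ Δ a → a < 2 * Δ → a / 2 < Δ
/2< Δ a h = *-cancelˡ-< 2 (a / 2) Δ (≤-trans (s≤s (≤-trans (≤-reflexive (*-comm 2 (a / 2))) (≤-trans (m≤n+m _ (a % 2)) (≤-reflexive (sym (m≡m%n+[m/n]*n a 2)))))) h)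

≡ᵇ-true⇒≡ : ∀ {a b} → (a ≡ᵇ b) ≡ true → a ≡ b
≡ᵇ-true⇒≡ {a} {b} e = ≡ᵇ⇒≡ a b (subst Bool.T (sym e) tt)

≢⇒≡ᵇ-false : ∀ {a b} → a ≢ b → (a ≡ᵇ b) ≡ false
≢⇒≡ᵇ-false {a} {b} ne with true-or-false (a ≡ᵇ b)
... | inj₁ e = ⊥-elim (ne (≡ᵇ-true⇒≡ e))
... | inj₂ e = e

==≡toℕ-≡ᵇ : ∀ {m} (x y : Fin m) → (x == y) ≡ (toℕ x ≡ᵇ toℕ y)
==≡toℕ-≡ᵇ x y with ≡-or-≢ x y
... | inj₁ refl = trans (==-refl x) (sym (≡ᵇ-refl (toℕ x)))
... | inj₂ ne = trans (≢⇒==-false ne) (sym (≢⇒≡ᵇ-false (λ e → ne (FP.toℕ-injective e))))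

injective-== : ∀ {m n} (g : Fin m → Fin n) → Injective _≡_ _≡_ g → ∀ x y → (g x == g y) ≡ (x == y)
injective-== g inj x y with ≡-or-≢ x y
... | inj₁ refl = trans (==-refl (g x)) (sym (==-refl x))
... | inj₂ ne = trans (≢⇒==-false (λ e → ne (inj e))) (sym (≢⇒==-false ne))

module OneRegular {n : ℕ} (G : Graph n) (Δ : ℕ) (regular : ∀ v → v ∈ supp G → deg G v ≡ 1) (∣supp∣≡Δ+Δ : ∣ supp G ∣ ≡ Δ + Δ) where
  A : Fin n → Fin n → Bool
  A = adj G
  inSupp : Fin n → Bool
  inSupp x = not (deg G x ≡ᵇ 0)
  supp-lookup : ∀ x → lookup (supp G) x ≡ inSupp x
  supp-lookup x = lookup∘tabulate (λ v → not (deg G v ≡ᵇ 0)) x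
  deg-one : ∀ x → inSupp x ≡ true → count (A x) ≡ 1
  deg-one x s = trans (sym (deg≡count G x)) (regular x (lookup⇒∈ (trans (supp-lookup x) s)))
  deg-zero : ∀ x → inSupp x ≡ false → count (A x) ≡ 0
  deg-zero x s = trans (sym (deg≡count G x)) (lem (deg G x) s)
    where
    lem : ∀ d → not (d ≡ᵇ 0) ≡ false → d ≡ 0
    lem zero e = refl
    lem (suc d) ()
  adj⇒inSupp : ∀ {x y} → A x y ≡ true → inSupp x ≡ true
  adj⇒inSupp {x} {y} e with true-or-false (inSupp x)
  ... | inj₁ s = s
  ... | inj₂ s = ⊥-elim (<-irrefl refl (≤-trans (count-≥1 (A x) y e) (≤-reflexive (deg-zero x s))))
  unique-neighbour : ∀ {x y z} → A x y ≡ true → A x z ≡ true → y ≡ z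
  unique-neighbour {x} {y} {z} ay az with ≡-or-≢ y z
  ... | inj₁ e = e
  ... | inj₂ ne = ⊥-elim (<-irrefl refl (≤-trans (s≤s (count-≥1 (remove (A x) y) z (∧-intro az (cong not (≢⇒==-false (λ e → ne (sym e)))))))
        (≤-trans (≤-reflexive (sym (count-remove (A x) y ay))) (≤-reflexive (deg-one x (adj⇒inSupp ay))))))
  mate : Fin n → Fin n
  mate x with search (A x)
  ... | inj₁ (y , _) = y
  ... | inj₂ _ = x
  mate-adj : ∀ x → inSupp x ≡ true → A x (mate x) ≡ true
  mate-adj x s with search (A x)
  ... | inj₁ (y , e) = e
  ... | inj₂ none = ⊥-elim (1+n≢0 (trans (sym (deg-one x s)) (count-none (A x) none)))
  mate-fixes : ∀ x → inSupp x ≡ false → mate x ≡ x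
  mate-fixes x s with search (A x)
  ... | inj₁ (y , e) = ⊥-elim (not-¬ (adj⇒inSupp e) s)
  ... | inj₂ h = refl
  adj⇒mate : ∀ {x y} → A x y ≡ true → mate x ≡ y
  adj⇒mate {x} {y} e = unique-neighbour (mate-adj x (adj⇒inSupp e)) e
  mate-involutive : Involutive _≡_ mate
  mate-involutive x with true-or-false (inSupp x)
  ... | inj₁ s = adj⇒mate (trans (Graph.sym G (mate x) x) (mate-adj x s))
  ... | inj₂ s = trans (cong mate (mate-fixes x s)) (mate-fixes x s)
  mate-moves : ∀ x → inSupp x ≡ true → mate x ≢ x
  mate-moves x s e = not-¬ (subst (λ w → A x w ≡ true) e (mate-adj x s)) (irrefl G x)
  adj≡mate : ∀ x y → A x y ≡ ((mate x == y) ∧ not (x == y))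
  adj≡mate x y with true-or-false (A x y)
  ... | inj₁ e = trans e (sym (cong₂ _∧_ rxy (cong not xy)))
    where
    rxy : (mate x == y) ≡ true
    rxy = subst (λ w → (mate x == w) ≡ true) (adj⇒mate e) (==-refl (mate x))
    xy : (x == y) ≡ false
    xy = ≢⇒==-false (λ q → not-¬ (subst (λ w → A x w ≡ true) (sym q) e) (irrefl G x))
  ... | inj₂ e with true-or-false (mate x == y)
  ... | inj₂ q rewrite e | q = refl
  ... | inj₁ q with true-or-false (inSupp x)
  ... | inj₁ s = ⊥-elim (not-¬ (subst (λ w → A x w ≡ true) (==⇒≡ q) (mate-adj x s)) e)
  ... | inj₂ s = trans e (sym (cong₂ _∧_ q (cong not (subst (λ w → (w == y) ≡ true) (mate-fixes x s) q))))
  moved≡inSupp : ∀ x → not (mate x == x) ≡ inSupp x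
  moved≡inSupp x with true-or-false (inSupp x)
  ... | inj₁ s rewrite s | ≢⇒==-false (mate-moves x s) = refl
  ... | inj₂ s rewrite s | mate-fixes x s | ==-refl x = refl

  lowerEnd : Fin n → Bool
  lowerEnd x = x <ᶠ mate x
  count-lowerEnd : count lowerEnd ≡ Δ
  count-lowerEnd = *-cancelʳ-≡ (count lowerEnd) Δ 2 (trans (sym (trans (count-moved≡2*ascents mate mate-involutive) (*-comm 2 (count lowerEnd)))) (trans (count-cong moved≡inSupp) (trans (sym (trans (∣∣≡count (supp G)) (count-cong supp-lookup))) (trans ∣supp∣≡Δ+Δ (trans (cong (Δ +_) (sym (+-identityʳ Δ))) (*-comm 2 Δ))))))
  open Enumeration (enumerate lowerEnd Δ count-lowerEnd) renaming (elem to e; injective to einj; member to eL; onto to esurj)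

  <ᶠ⇒< : ∀ {x y : Fin n} → (x <ᶠ y) ≡ true → toℕ x < toℕ y
  <ᶠ⇒< {x} {y} h = <ᵇ⇒< (toℕ x) (toℕ y) (subst Bool.T (sym h) tt)
  <⇒<ᶠ : ∀ {x y : Fin n} → toℕ x < toℕ y → (x <ᶠ y) ≡ true
  <⇒<ᶠ {x} {y} h with true-or-false ((x <ᶠ y))
  ... | inj₁ q = q
  ... | inj₂ q = ⊥-elim (subst Bool.T q (<⇒<ᵇ h))
  ≤⇒<ᶠ-false : ∀ {x y : Fin n} → toℕ y ≤ toℕ x → (x <ᶠ y) ≡ false
  ≤⇒<ᶠ-false {x} {y} h with true-or-false ((x <ᶠ y))
  ... | inj₂ q = q
  ... | inj₁ q = ⊥-elim (<-irrefl refl (≤-trans (<ᶠ⇒< q) h))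

  lowerEnd-mate : ∀ x → lowerEnd x ≡ true → lowerEnd (mate x) ≡ false
  lowerEnd-mate x h = subst (λ w → ((mate x) <ᶠ w) ≡ false) (sym (mate-involutive x)) (≤⇒<ᶠ-false {mate x} {x} (<⇒≤ (<ᶠ⇒< {x} {mate x} h)))
  inSupp-mate : ∀ x → inSupp (mate x) ≡ inSupp x
  inSupp-mate x = trans (sym (moved≡inSupp (mate x))) (trans (cong (λ w → not (w == mate x)) (mate-involutive x)) (trans (cong not (==-sym x (mate x))) (moved≡inSupp x)))
  lowerEnd⇒inSupp : ∀ x → lowerEnd x ≡ true → inSupp x ≡ true
  lowerEnd⇒inSupp x h = trans (sym (moved≡inSupp x)) (cong not (≢⇒==-false (λ q → <-irrefl refl (subst (λ w → toℕ x < toℕ w) q (<ᶠ⇒< {x} {mate x} h)))))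

  pick : ℕ → Fin n → Fin n
  pick zero x = x
  pick (suc _) x = mate x

  edgeIndex : Fin (2 * Δ) → Fin Δ
  edgeIndex i = fromℕ< (/2< Δ (toℕ i) (FP.toℕ<n i))
  toℕ-edgeIndex : ∀ i → toℕ (edgeIndex i) ≡ toℕ i / 2
  toℕ-edgeIndex i = FP.toℕ-fromℕ< (/2< Δ (toℕ i) (FP.toℕ<n i))

  -- Vertex 2j + b of Δ K² is sent to the smaller (b = 0) or larger (b = 1) end of the j-th edge.
  φ : Fin (2 * Δ) → Fin n
  φ i = pick (toℕ i % 2) (e (edgeIndex i))

  bit : ∀ a → a % 2 ≡ 0 ⊎ a % 2 ≡ 1
  bit a with a % 2 | m%n<n a 2
  ... | zero | _ = inj₁ refl
  ... | suc zero | _ = inj₂ refl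
  ... | suc (suc _) | s≤s (s≤s ())

  decomp : ∀ i → toℕ i ≡ toℕ i % 2 + toℕ (edgeIndex i) * 2
  decomp i = trans (m≡m%n+[m/n]*n (toℕ i) 2) (cong (λ w → toℕ i % 2 + w * 2) (sym (toℕ-edgeIndex i)))

  φ-even : ∀ i → toℕ i % 2 ≡ 0 → φ i ≡ e (edgeIndex i)
  φ-even i h = cong (λ w → pick w (e (edgeIndex i))) h
  φ-odd : ∀ i → toℕ i % 2 ≡ 1 → φ i ≡ mate (e (edgeIndex i))
  φ-odd i h = cong (λ w → pick w (e (edgeIndex i))) h

  lowerEnd-φ-even : ∀ i → toℕ i % 2 ≡ 0 → lowerEnd (φ i) ≡ true
  lowerEnd-φ-even i h = trans (cong lowerEnd (φ-even i h)) (eL (edgeIndex i))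
  lowerEnd-φ-odd : ∀ i → toℕ i % 2 ≡ 1 → lowerEnd (φ i) ≡ false
  lowerEnd-φ-odd i h = trans (cong lowerEnd (φ-odd i h)) (lowerEnd-mate _ (eL (edgeIndex i)))

  mate-injective : ∀ {x y} → mate x ≡ mate y → x ≡ y
  mate-injective {x} {y} q = trans (sym (mate-involutive x)) (trans (cong mate q) (mate-involutive y))

  φ-injective : Injective _≡_ _≡_ φ
  φ-injective {i} {i'} q with bit (toℕ i) | bit (toℕ i')
  ... | inj₁ b | inj₁ b' = FP.toℕ-injective (trans (decomp i) (trans (cong₂ (λ u w → u + toℕ w * 2) (trans b (sym b')) jj) (sym (decomp i'))))
    where
    jj : edgeIndex i ≡ edgeIndex i'
    jj = einj (trans (sym (φ-even i b)) (trans q (φ-even i' b')))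
  ... | inj₂ b | inj₂ b' = FP.toℕ-injective (trans (decomp i) (trans (cong₂ (λ u w → u + toℕ w * 2) (trans b (sym b')) jj) (sym (decomp i'))))
    where
    jj : edgeIndex i ≡ edgeIndex i'
    jj = einj (mate-injective (trans (sym (φ-odd i b)) (trans q (φ-odd i' b'))))
  ... | inj₁ b | inj₂ b' = ⊥-elim (not-¬ (lowerEnd-φ-even i b) (trans (cong lowerEnd q) (lowerEnd-φ-odd i' b')))
  ... | inj₂ b | inj₁ b' = ⊥-elim (not-¬ (lowerEnd-φ-even i' b') (trans (cong lowerEnd (sym q)) (lowerEnd-φ-odd i b)))

  φ-∈supp : ∀ i → φ i ∈ supp G
  φ-∈supp i = lookup⇒∈ (trans (supp-lookup (φ i)) (lem (bit (toℕ i))))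
    where
    lem : (toℕ i % 2 ≡ 0 ⊎ toℕ i % 2 ≡ 1) → inSupp (φ i) ≡ true
    lem (inj₁ b) = trans (cong inSupp (φ-even i b)) (lowerEnd⇒inSupp _ (eL (edgeIndex i)))
    lem (inj₂ b) = trans (cong inSupp (φ-odd i b)) (trans (inSupp-mate _) (lowerEnd⇒inSupp _ (eL (edgeIndex i))))

  index-of : (j : Fin Δ) (b : ℕ) → b < 2 → Σ (Fin (2 * Δ)) λ i → (toℕ i % 2 ≡ b) × (edgeIndex i ≡ j)
  index-of j b b<2 = i , m , FP.toℕ-injective (trans (toℕ-edgeIndex i) (trans (cong (_/ 2) ti) ([b+j*2]/2≡j (toℕ j) b b<2)))
    where
    i = fromℕ< (b+j*2<2*Δ Δ (toℕ j) b (FP.toℕ<n j) b<2)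
    ti : toℕ i ≡ b + toℕ j * 2
    ti = FP.toℕ-fromℕ< (b+j*2<2*Δ Δ (toℕ j) b (FP.toℕ<n j) b<2)
    m : toℕ i % 2 ≡ b
    m = trans (cong (_% 2) ti) ([b+j*2]%2≡b (toℕ j) b b<2)

  φ-onto : ∀ v → v ∈ supp G → Σ (Fin (2 * Δ)) λ i → φ i ≡ v
  φ-onto v vin with true-or-false (lowerEnd v)
  ... | inj₁ Lv = let (j , ej) = esurj v Lv ; (i , m , jj) = index-of j 0 (s≤s z≤n) in
        i , trans (φ-even i m) (trans (cong e jj) ej)
  ... | inj₂ nL = let (j , ej) = esurj (mate v) Lrv ; (i , m , jj) = index-of j 1 (s≤s (s≤s z≤n)) in
        i , trans (φ-odd i m) (trans (cong (mate ∘ e) jj) (trans (cong mate ej) (mate-involutive v)))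
    where
    spv : inSupp v ≡ true
    spv = trans (sym (supp-lookup v)) (∈⇒lookup vin)
    Lrv : lowerEnd (mate v) ≡ true
    Lrv = subst (λ w → ((mate v) <ᶠ w) ≡ true) (sym (mate-involutive v)) (<⇒<ᶠ (lem (toℕ v) (toℕ (mate v)) (λ q → mate-moves v spv (FP.toℕ-injective (sym q))) (λ q → not-¬ (<⇒<ᶠ q) nL)))
      where
      lem : ∀ a c → a ≢ c → ¬ (a < c) → c < a
      lem a c ne nl with <-cmp a c
      ... | tri< l _ _ = ⊥-elim (nl l)
      ... | tri≈ _ q _ = ⊥-elim (ne q)
      ... | tri> _ _ g = g

  sameB : ∀ b x y a a' → a ≡ b + x * 2 → a' ≡ b + y * 2 → ((x ≡ᵇ y) ∧ not (a ≡ᵇ a')) ≡ false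
  sameB b x y a a' ea ea' with true-or-false (x ≡ᵇ y)
  ... | inj₂ q rewrite q = refl
  ... | inj₁ q rewrite q | ≡ᵇ-true⇒≡ {x} {y} q | ea | ea' | ≡ᵇ-refl (b + y * 2) = refl

  diffB : ∀ x y a a' → a ≡ 0 + x * 2 → a' ≡ 1 + y * 2 → (a ≡ᵇ a') ≡ false
  diffB x y a a' ea ea' = ≢⇒≡ᵇ-false (λ q → 0≢1 (trans (sym ([b+j*2]%2≡b x 0 (s≤s z≤n))) (trans (cong (_% 2) (trans (sym ea) (trans q ea'))) ([b+j*2]%2≡b y 1 (s≤s (s≤s z≤n))))))
    where
    0≢1 : 0 ≢ 1
    0≢1 ()

  Ldiff : ∀ {x y} → lowerEnd x ≡ true → lowerEnd y ≡ false → (x == y) ≡ false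
  Ldiff {x} {y} lx ly = ≢⇒==-false (λ q → not-¬ lx (trans (cong lowerEnd q) ly))

  Ldiff2 : ∀ {x y} → lowerEnd x ≡ false → lowerEnd y ≡ true → (x == y) ≡ false
  Ldiff2 {x} {y} lx ly = ≢⇒==-false (λ q → not-¬ ly (trans (cong lowerEnd (sym q)) lx))

  mate∘e-injective : Injective _≡_ _≡_ (mate ∘ e)
  mate∘e-injective q = einj (mate-injective q)

  φ-adj : ∀ i i' → adj G (φ i) (φ i') ≡ (((toℕ i / 2) ≡ᵇ (toℕ i' / 2)) ∧ not (toℕ i ≡ᵇ toℕ i'))
  φ-adj i i' = trans (adj≡mate (φ i) (φ i')) (trans (main (bit (toℕ i)) (bit (toℕ i')))
                (cong₂ (λ u w → (u ≡ᵇ w) ∧ not (toℕ i ≡ᵇ toℕ i')) (toℕ-edgeIndex i) (toℕ-edgeIndex i')))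
    where
    j = edgeIndex i
    j' = edgeIndex i'
    Ja = toℕ j
    Jb = toℕ j'
    LHS = (mate (φ i) == φ i') ∧ not (φ i == φ i')
    RHS = (Ja ≡ᵇ Jb) ∧ not (toℕ i ≡ᵇ toℕ i')
    da : ∀ {b} → toℕ i % 2 ≡ b → toℕ i ≡ b + Ja * 2
    da e' = trans (decomp i) (cong (λ w → w + Ja * 2) e')
    da' : ∀ {b} → toℕ i' % 2 ≡ b → toℕ i' ≡ b + Jb * 2
    da' e' = trans (decomp i') (cong (λ w → w + Jb * 2) e')
    ∧t : ∀ a → (a ∧ true) ≡ a
    ∧t true = refl
    ∧t false = refl
    main : (toℕ i % 2 ≡ 0 ⊎ toℕ i % 2 ≡ 1) → (toℕ i' % 2 ≡ 0 ⊎ toℕ i' % 2 ≡ 1) → LHS ≡ RHS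
    main (inj₁ b) (inj₁ b') = trans (cong₂ (λ u w → (mate u == w) ∧ not (u == w)) (φ-even i b) (φ-even i' b'))
      (trans (cong (λ z → z ∧ not (e j == e j')) (Ldiff2 (lowerEnd-mate _ (eL j)) (eL j')))
        (sym (sameB 0 Ja Jb (toℕ i) (toℕ i') (da b) (da' b'))))
    main (inj₂ b) (inj₂ b') = trans (cong₂ (λ u w → (mate u == w) ∧ not (u == w)) (φ-odd i b) (φ-odd i' b'))
      (trans (cong (λ z → z ∧ not (mate (e j) == mate (e j'))) (trans (cong (_== mate (e j')) (mate-involutive (e j))) (Ldiff (eL j) (lowerEnd-mate _ (eL j')))))
        (sym (sameB 1 Ja Jb (toℕ i) (toℕ i') (da b) (da' b'))))
    main (inj₁ b) (inj₂ b') = trans (cong₂ (λ u w → (mate u == w) ∧ not (u == w)) (φ-even i b) (φ-odd i' b'))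
      (trans (cong₂ (λ u w → u ∧ not w) (injective-== (mate ∘ e) mate∘e-injective j j') (Ldiff (eL j) (lowerEnd-mate _ (eL j'))))
        (trans (∧t (j == j')) (trans (==≡toℕ-≡ᵇ j j') (sym (trans (cong (λ w → (Ja ≡ᵇ Jb) ∧ not w) (diffB Ja Jb (toℕ i) (toℕ i') (da b) (da' b'))) (∧t (Ja ≡ᵇ Jb)))))))
    main (inj₂ b) (inj₁ b') = trans (cong₂ (λ u w → (mate u == w) ∧ not (u == w)) (φ-odd i b) (φ-even i' b'))
      (trans (cong₂ (λ u w → u ∧ not w) (trans (cong (_== e j') (mate-involutive (e j))) (injective-== e einj j j')) (Ldiff2 (lowerEnd-mate _ (eL j)) (eL j')))
        (trans (∧t (j == j')) (trans (==≡toℕ-≡ᵇ j j') (sym (trans (cong (λ w → (Ja ≡ᵇ Jb) ∧ not w) (trans (≡ᵇ-sym (toℕ i) (toℕ i')) (diffB Jb Ja (toℕ i') (toℕ i) (da' b') (da b)))) (∧t (Ja ≡ᵇ Jb)))))))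

  ≅matching : InducedIso G (supp G) (matching Δ)
  ≅matching = φ , φ-injective , φ-∈supp , φ-onto , φ-adj

anyᵇ-cong : ∀ {k} (f g : Fin k → Bool) → (∀ i → f i ≡ g i) → anyᵇ f ≡ anyᵇ g
anyᵇ-cong {zero}  f g f≗g = refl
anyᵇ-cong {suc k} f g f≗g = cong₂ _∨_ (f≗g fz) (anyᵇ-cong (f ∘ fs) (g ∘ fs) (f≗g ∘ fs))

anyᵇ-none : ∀ {k} (f : Fin k → Bool) → (∀ i → f i ≡ false) → anyᵇ f ≡ false
anyᵇ-none {zero}  f none = refl
anyᵇ-none {suc k} f none rewrite none fz = anyᵇ-none (f ∘ fs) (none ∘ fs)

adj⇒∈supp : ∀ {n} (G : Graph n) {u v} → adj G u v ≡ true → u ∈ supp G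
adj⇒∈supp G {u} {v} uv =
  lookup⇒∈ (trans (lookup∘tabulate _ u) (positive (subst (1 ≤_) (sym (deg≡count G u)) (count-≥1 (adj G u) v uv))))
  where
  positive : ∀ {d} → 1 ≤ d → not (d ≡ᵇ 0) ≡ true
  positive (s≤s _) = refl

degree<∣supp∣ : ∀ {n k} (G : Graph n) → PlusRegular G k → ∀ {v} → v ∈ supp G → k < ∣ supp G ∣
degree<∣supp∣ {k = k} G regular {v} v∈supp = begin-strict
  k                                    ≡⟨ trans (sym (regular v v∈supp)) (deg≡count G v) ⟩
  count (adj G v)                      ≤⟨ count-mono neighbours⊆supp∖v ⟩
  count (remove (lookup (supp G)) v)   <⟨ n<1+n _ ⟩
  suc (count (remove (lookup (supp G)) v)) ≡⟨ count-remove _ v (∈⇒lookup v∈supp) ⟨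
  count (lookup (supp G))              ≡⟨ ∣∣≡count (supp G) ⟨
  ∣ supp G ∣                           ∎
  where
  open ≤-Reasoning
  neighbours⊆supp∖v : adj G v ⊆ᵇ remove (lookup (supp G)) v
  neighbours⊆supp∖v y vy =
    ∧-intro (∈⇒lookup (adj⇒∈supp G (trans (Graph.sym G y v) vy)))
            (cong not (≢⇒==-false (λ y≡v → not-¬ (subst (λ w → adj G v w ≡ true) y≡v vy) (irrefl G v))))

degSeq-constant : ∀ {n k} (G : Graph n) (S : Subset n) → (∀ x → x ∈ S → deg G x ≡ k) →
  degSeq G S ≡ replicate ∣ S ∣ k
degSeq-constant {k = k} G S constant =
  trans (map-const (deg G) k (elems S) (All.map (λ {x} x∈S → constant x (lookup⇒∈ x∈S)) (elems-⊆ S)))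
        (cong (λ m → replicate m k) (length-elems S))

module UnionOf {n k : ℕ} (X : Subset n) {B : Fin n → Fin n → Bool}
               (K : DisjointPerfectMatchings (lookup X) B k) where
  open DisjointPerfectMatchings K

  edge : Fin k → Fin n → Fin n → Bool
  edge i u v = (pm i u == v) ∧ not (u == v)

  edge-sym : ∀ i u v → edge i u v ≡ edge i v u
  edge-sym i u v = cong₂ (λ a b → a ∧ not b) (involution-== (pm i) (pm-involutive i) u v) (==-sym u v)

  edge-irrefl : ∀ i v → edge i v v ≡ false
  edge-irrefl i v rewrite ==-refl v = ∧-zeroʳ _

  matchingGraph : Fin k → Graph n
  matchingGraph i = record { adj = edge i ; sym = edge-sym i ; irrefl = edge-irrefl i }

  unionGraph : Graph n
  unionGraph = record
    { adj    = λ u v → anyᵇ (λ i → edge i u v)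
    ; sym    = λ u v → anyᵇ-cong _ _ (λ i → edge-sym i u v)
    ; irrefl = λ v → anyᵇ-none _ (λ i → edge-irrefl i v) }

  edge⇒pm : ∀ {i u v} → edge i u v ≡ true → pm i u ≡ v × u ≢ v
  edge⇒pm {i} {u} {v} e =
    ==⇒≡ (∧-conicalˡ (pm i u == v) _ e) , ==-false⇒≢ (not-injective (∧-conicalʳ (pm i u == v) _ e))

  edge⇒∈X : ∀ {i u v} → edge i u v ≡ true → u ∈ X
  edge⇒∈X {i} {u} e with lookup X u in u∈X
  ... | true  = lookup⇒∈ u∈X
  ... | false = ⊥-elim (proj₂ (edge⇒pm e) (trans (sym (pm-fixes i u u∈X)) (proj₁ (edge⇒pm e))))

  edge-from-X : ∀ i {x} → lookup X x ≡ true → ∀ v → edge i x v ≡ (pm i x == v)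
  edge-from-X i {x} x∈X v with pm i x FP.≟ v
  ... | no _     = refl
  ... | yes refl rewrite ≢⇒==-false (≢-sym (pm-moves i x x∈X)) = refl

  deg-matchingGraph : ∀ i x → x ∈ X → deg (matchingGraph i) x ≡ 1
  deg-matchingGraph i x x∈X = begin
    deg (matchingGraph i) x  ≡⟨ deg≡count (matchingGraph i) x ⟩
    count (edge i x)         ≡⟨ count-cong (λ v → trans (edge-from-X i (∈⇒lookup x∈X) v) (==-sym (pm i x) v)) ⟩
    count (_== pm i x)       ≡⟨ count-== (pm i x) ⟩
    1                        ∎
    where open ≡-Reasoning

  deg-unionGraph : ∀ x → x ∈ X → deg unionGraph x ≡ k
  deg-unionGraph x x∈X = begin
    deg unionGraph x                        ≡⟨ deg≡count unionGraph x ⟩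
    count (λ v → anyᵇ (λ i → edge i x v))   ≡⟨ count-cong (λ v → anyᵇ-cong _ _ (λ i → edge-from-X i (∈⇒lookup x∈X) v)) ⟩
    count (λ v → anyᵇ (λ i → pm i x == v))  ≡⟨ count-image (λ i → pm i x) partners-distinct ⟩
    k                                       ∎
    where
    open ≡-Reasoning
    partners-distinct : Injective _≡_ _≡_ (λ i → pm i x)
    partners-distinct {i} {j} same with i FP.≟ j
    ... | yes i≡j = i≡j
    ... | no i≢j  = ⊥-elim (pm-disjoint i j i≢j x (∈⇒lookup x∈X) same)

  matchingGraphs-disjoint : ∀ i j → i ≢ j → EdgeDisjoint (matchingGraph i) (matchingGraph j)
  matchingGraphs-disjoint i j i≢j u v e =
    cong (λ b → b ∧ not (u == v))
         (≢⇒==-false (λ pmj≡v → pm-disjoint i j i≢j u (∈⇒lookup (edge⇒∈X e)) (trans (proj₁ (edge⇒pm e)) (sym pmj≡v))))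

  realises : ∀ (G₁ : Graph n) → PlusRegular G₁ k → ∣ X ∣ ≡ ∣ supp G₁ ∣ →
    Σ (Graph n) λ H →
      OnVertexSet H X
      × degSeq H X ↭ degSeq G₁ (supp G₁)
      × Σ (Fin k → Graph n) (λ M →
          (∀ i → OneFactor H X (M i))
          × (∀ i j → i ≢ j → EdgeDisjoint (M i) (M j)))
      × (∀ u v → u ∈ X → v ∈ X → adj H u v ≡ true → B u v ≡ false)
  realises G₁ regular ∣X∣≡∣supp∣ =
    unionGraph , on-X , ↭-reflexive same-degrees ,
    (matchingGraph , (λ i → (λ u v e → anyᵇ-intro _ i e) , deg-matchingGraph i) , matchingGraphs-disjoint) ,
    avoids
    where
    open ≡-Reasoning
    on-X : OnVertexSet unionGraph X
    on-X u v uv = edge⇒∈X {v = v} (proj₂ (anyᵇ-witness (λ i → edge i u v) uv))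
    same-degrees : degSeq unionGraph X ≡ degSeq G₁ (supp G₁)
    same-degrees = begin
      degSeq unionGraph X           ≡⟨ degSeq-constant unionGraph X deg-unionGraph ⟩
      replicate (∣ X ∣) k           ≡⟨ cong (λ m → replicate m k) ∣X∣≡∣supp∣ ⟩
      replicate (∣ supp G₁ ∣) k     ≡⟨ degSeq-constant G₁ (supp G₁) regular ⟨
      degSeq G₁ (supp G₁)           ∎
    avoids : ∀ u v → u ∈ X → v ∈ X → adj unionGraph u v ≡ true → B u v ≡ false
    avoids u v u∈X _ uv = let (i , e) = anyᵇ-witness (λ i → edge i u v) uv in
      subst (λ w → B u w ≡ false) (proj₁ (edge⇒pm e)) (pm-avoids i u (∈⇒lookup u∈X))

clique⇒containsComplete : ∀ {n} (G : Graph n) (X : Subset n) (Δ : ℕ) (I : Fin n → Bool) → I ⊆ᵇ lookup X →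
  count I ≡ suc Δ → (∀ x y → I x ≡ true → I y ≡ true → x ≢ y → adj G x y ≡ true) →
  ContainsSub G X (complete (Δ + 1))
clique⇒containsComplete G X Δ I I⊆X ∣I∣ clique = elem , injective , (λ i → lookup⇒∈ (I⊆X (elem i) (member i))) , edges
  where
  open Enumeration (enumerate I (Δ + 1) (trans ∣I∣ (+-comm 1 Δ)))
  edges : ∀ i j → adj (complete (Δ + 1)) i j ≡ true → adj G (elem i) (elem j) ≡ true
  edges i j i≠j = clique (elem i) (elem j) (member i) (member j)
    (λ same → not-¬ (subst (λ w → (toℕ i ≡ᵇ toℕ w) ≡ true) (injective same) (≡ᵇ-refl (toℕ i))) (not-injective i≠j))

bipartite⇒≅completeBip : ∀ {n} (G : Graph n) (X : Subset n) (Δ : ℕ) (U : Fin n → Bool) → (U ⊆ᵇ lookup X) →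
  count U ≡ Δ →
  count (λ x → lookup X x ∧ not (U x)) ≡ Δ →
  (∀ x y → lookup X x ≡ true → lookup X y ≡ true → adj G x y ≡ (U x xor U y)) → InducedIso G X (completeBip Δ)
bipartite⇒≅completeBip {n} G X Δ U UX cU cV BU = φ , φ-injective , φ-∈X , φ-onto , φ-adj
  where
  Xf = lookup X
  V : Fin n → Bool
  V x = Xf x ∧ not (U x)
  module EU = Enumeration (enumerate U Δ cU)
  module EV = Enumeration (enumerate V (Δ + 0) (trans cV (sym (+-identityʳ Δ))))
  eU = EU.elem
  eV = EV.elem
  φ : Fin (2 * Δ) → Fin n
  φ i = [ eU , eV ]′ (splitAt Δ i)
  UV : ∀ {y z} → U y ≡ true → V z ≡ true → y ≢ z
  UV {y} Uy Vz refl = not-¬ Uy (not-injective (∧-conicalʳ (Xf y) _ Vz))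
  view : ∀ i → (Σ (Fin Δ) λ a → (splitAt Δ i ≡ inj₁ a)) ⊎ (Σ (Fin (Δ + 0)) λ b → (splitAt Δ i ≡ inj₂ b))
  view i with splitAt Δ i
  ... | inj₁ a = inj₁ (a , refl)
  ... | inj₂ b = inj₂ (b , refl)
  φ-left : ∀ {i a} → splitAt Δ i ≡ inj₁ a → φ i ≡ eU a
  φ-left e = cong [ eU , eV ]′ e
  φ-right : ∀ {i b} → splitAt Δ i ≡ inj₂ b → φ i ≡ eV b
  φ-right e = cong [ eU , eV ]′ e
  φ-injective : Injective _≡_ _≡_ φ
  φ-injective {i} {j} q with view i | view j
  ... | inj₁ (a , ea) | inj₁ (a' , ea') = trans (sym (FP.splitAt⁻¹-↑ˡ ea)) (trans (cong (_↑ˡ (Δ + 0)) (EU.injective (trans (sym (φ-left ea)) (trans q (φ-left ea'))))) (FP.splitAt⁻¹-↑ˡ ea'))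
  ... | inj₂ (b , eb) | inj₂ (b' , eb') = trans (sym (FP.splitAt⁻¹-↑ʳ eb)) (trans (cong (Δ ↑ʳ_) (EV.injective (trans (sym (φ-right eb)) (trans q (φ-right eb'))))) (FP.splitAt⁻¹-↑ʳ eb'))
  ... | inj₁ (a , ea) | inj₂ (b , eb) = ⊥-elim (UV (EU.member a) (EV.member b) (trans (sym (φ-left ea)) (trans q (φ-right eb))))
  ... | inj₂ (b , eb) | inj₁ (a , ea) = ⊥-elim (UV (EU.member a) (EV.member b) (trans (sym (φ-left ea)) (trans (sym q) (φ-right eb))))
  φ-∈X : ∀ i → φ i ∈ X
  φ-∈X i with view i
  ... | inj₁ (a , ea) = lookup⇒∈ (subst (λ w → Xf w ≡ true) (sym (φ-left ea)) (UX _ (EU.member a)))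
  ... | inj₂ (b , eb) = lookup⇒∈ (subst (λ w → Xf w ≡ true) (sym (φ-right eb)) (∧-conicalˡ (Xf (eV b)) _ (EV.member b)))
  φ-onto : ∀ v → v ∈ X → ∃ λ i → φ i ≡ v
  φ-onto v vin with true-or-false (U v)
  ... | inj₁ uv = let (a , ea) = EU.onto v uv in (a ↑ˡ (Δ + 0)) , trans (φ-left (FP.splitAt-↑ˡ Δ a (Δ + 0))) ea
  ... | inj₂ nu = let (b , eb) = EV.onto v vv in (Δ ↑ʳ b) , trans (φ-right (FP.splitAt-↑ʳ Δ (Δ + 0) b)) eb
    where
    vv : V v ≡ true
    vv rewrite ∈⇒lookup vin | nu = refl
  U∘φ : ∀ i → U (φ i) ≡ (toℕ i <ᵇ Δ)
  U∘φ i with view i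
  ... | inj₁ (a , ea) = trans (cong U (φ-left ea)) (trans (EU.member a) (sym (lem (toℕ-eq))))
    where
    toℕ-eq : toℕ i ≡ toℕ a
    toℕ-eq = trans (cong toℕ (sym (FP.splitAt⁻¹-↑ˡ ea))) (FP.toℕ-↑ˡ a (Δ + 0))
    lem : toℕ i ≡ toℕ a → (toℕ i <ᵇ Δ) ≡ true
    lem e with true-or-false (toℕ i <ᵇ Δ)
    ... | inj₁ r = r
    ... | inj₂ r = ⊥-elim (subst Bool.T r (<⇒<ᵇ (subst (_< Δ) (sym e) (FP.toℕ<n a))))
  ... | inj₂ (b , eb) = trans (cong U (φ-right eb)) (trans (not-injective (∧-conicalʳ (Xf (eV b)) _ (EV.member b))) (sym lem))
    where
    toℕ-eq : toℕ i ≡ Δ + toℕ b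
    toℕ-eq = trans (cong toℕ (sym (FP.splitAt⁻¹-↑ʳ eb))) (FP.toℕ-↑ʳ Δ b)
    lem : (toℕ i <ᵇ Δ) ≡ false
    lem with true-or-false (toℕ i <ᵇ Δ)
    ... | inj₂ r = r
    ... | inj₁ r = ⊥-elim (<-irrefl refl (≤-trans (<ᵇ⇒< _ _ (subst Bool.T (sym r) tt)) (≤-trans (m≤m+n Δ (toℕ b)) (≤-reflexive (sym toℕ-eq)))))
  φ-adj : ∀ i j → adj G (φ i) (φ j) ≡ adj (completeBip Δ) i j
  φ-adj i j = trans (BU (φ i) (φ j) (∈⇒lookup (φ-∈X i)) (∈⇒lookup (φ-∈X j))) (cong₂ _xor_ (U∘φ i) (U∘φ j))

extremal⇒exceptional : ∀ {n Δ} (G₁ G₂ : Graph n) (X : Subset n) → PlusRegular G₁ 1 →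
  count (lookup X) ≡ ∣ supp G₁ ∣ → ExtremalConfigurations.Extremal (lookup X) (adj G₂) Δ →
  ∣ supp G₁ ∣ ≡ 2 * Δ
  × ((InducedIso G₁ (supp G₁) (matching Δ) × InducedIso G₂ X (completeBip Δ) × Δ % 2 ≡ 1)
     ⊎ (InducedIso G₁ (supp G₁) (matching Δ) × ContainsSub G₂ X (complete (Δ + 1))))
extremal⇒exceptional {Δ = Δ} G₁ G₂ X regular ∣X∣≡∣supp∣ (∣X∣≡Δ+Δ , configuration) =
  trans ∣supp∣≡Δ+Δ (cong (Δ +_) (sym (+-identityʳ Δ))) , exception configuration
  where
  open ExtremalConfigurations (lookup X) (adj G₂) Δ
  ∣supp∣≡Δ+Δ : ∣ supp G₁ ∣ ≡ Δ + Δ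
  ∣supp∣≡Δ+Δ = trans (sym ∣X∣≡∣supp∣) ∣X∣≡Δ+Δ
  G₁≅matching : InducedIso G₁ (supp G₁) (matching Δ)
  G₁≅matching = OneRegular.≅matching G₁ Δ regular ∣supp∣≡Δ+Δ
  exception : LargeClique ⊎ OddBipartite →
    (InducedIso G₁ (supp G₁) (matching Δ) × InducedIso G₂ X (completeBip Δ) × Δ % 2 ≡ 1)
    ⊎ (InducedIso G₁ (supp G₁) (matching Δ) × ContainsSub G₂ X (complete (Δ + 1)))
  exception (inj₁ (I , I⊆X , ∣I∣ , clique)) = inj₂ (G₁≅matching , clique⇒containsComplete G₂ X Δ I I⊆X ∣I∣ clique)
  exception (inj₂ (U , U⊆X , ∣U∣ , ∣X∖U∣ , bipartite , (c , odd))) =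
    inj₁ (G₁≅matching , bipartite⇒≅completeBip G₂ X Δ U U⊆X ∣U∣ ∣X∖U∣ bipartite ,
          trans (cong (_% 2) odd) ([b+j*2]%2≡b c 1 (s≤s (s≤s z≤n))))

mainTheorem3 : (n k Δ₂ : ℕ) (G₁ G₂ : Graph n) →
  Δ₂ ≡ maxDeg G₂ →
  PlusRegular G₁ k →
  ∣ supp G₁ ∣ % 2 ≡ 0 →
  2 * Δ₂ + 2 * k ≤ ∣ supp G₁ ∣ + 2 →
  (X : Subset n) → ∣ X ∣ ≡ ∣ supp G₁ ∣ →
  ¬ (∣ supp G₁ ∣ ≡ 2 * Δ₂
     × ((InducedIso G₁ (supp G₁) (matching Δ₂)
         × InducedIso G₂ X (completeBip Δ₂) × Δ₂ % 2 ≡ 1)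
        ⊎ (InducedIso G₁ (supp G₁) (matching Δ₂)
           × ContainsSub G₂ X (complete (Δ₂ + 1))))) →
  Σ (Graph n) λ H →
    OnVertexSet H X
    × degSeq H X ↭ degSeq G₁ (supp G₁)
    × Σ (Fin k → Graph n) (λ M →
        (∀ i → OneFactor H X (M i))
        × (∀ i j → i ≢ j → EdgeDisjoint (M i) (M j)))
    × (∀ u v → u ∈ X → v ∈ X → adj H u v ≡ true → adj G₂ u v ≡ false)
mainTheorem3 n k Δ₂ G₁ G₂ Δ₂≡maxDeg regular even bound X ∣X∣≡∣supp∣ not-exceptional
  with disjointPerfectMatchings (lookup X) (∣ supp G₁ ∣ / 2) size-even k (adj G₂) (Graph.sym G₂) (irrefl G₂) Δ₂
         degree-bound size-bound k<size
  where
  size : count (lookup X) ≡ ∣ supp G₁ ∣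
  size = trans (sym (∣∣≡count X)) ∣X∣≡∣supp∣
  size-even : count (lookup X) ≡ ∣ supp G₁ ∣ / 2 * 2
  size-even = trans size (trans (m≡m%n+[m/n]*n _ 2) (cong (_+ ∣ supp G₁ ∣ / 2 * 2) even))
  degree-bound : ∀ x → lookup X x ≡ true → count (λ y → lookup X y ∧ adj G₂ x y) ≤ Δ₂
  degree-bound x _ = subst (count (λ y → lookup X y ∧ adj G₂ x y) ≤_) (sym Δ₂≡maxDeg) (neighbours-in≤maxDeg G₂ (lookup X) x)
  size-bound : Δ₂ + Δ₂ + k + k ≤ count (lookup X) + 2
  size-bound = subst (λ N → Δ₂ + Δ₂ + k + k ≤ N + 2) (sym size) (2Δ+2k⇒Δ+Δ+k+k Δ₂ k ∣ supp G₁ ∣ bound)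
  k<size : 2 ≤ k → k < count (lookup X)
  k<size 2≤k = subst (k <_) (sym size) (degree<∣supp∣ G₁ regular (lookup⇒∈ (proj₂ some-vertex)))
    where
    some-vertex : Σ (Fin n) λ v → lookup (supp G₁) v ≡ true
    some-vertex = count-witness (lookup (supp G₁))
      (subst (1 ≤_) (∣∣≡count (supp G₁)) (≤-trans (s≤s z≤n) (size≥2 Δ₂ k ∣ supp G₁ ∣ (2Δ+2k⇒Δ+Δ+k+k Δ₂ k ∣ supp G₁ ∣ bound) 2≤k)))
... | inj₁ K = UnionOf.realises X K G₁ regular ∣X∣≡∣supp∣
... | inj₂ (refl , extremal) = ⊥-elim (not-exceptional (extremal⇒exceptional G₁ G₂ X regular (trans (sym (∣∣≡count X)) ∣X∣≡∣supp∣) extremal))
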